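{- Define $K_0(x) = 0$ and $K_j(x) = \dfrac{x}{1-x-K_{j-1}(x)}$ for $j\ge1$ (so $K_j$ is the finite continued fraction $\cfrac{x}{1-x-\cfrac{x}{1-x-\cdots-\cfrac{x}{1-x}}}$ with $j$ denominators). Then for all $k\ge1$, $$\sum_{n=0}^\infty |\mathfrak{S}_n(1243,2143,12\cdots k)|\,x^n = 1 + K_{k-1}(x).$$
   Context: $\mathfrak{S}_n(R)$ is the set of permutations of $\{1,\dots,n\}$ containing no subsequence with the same relative order as any pattern in $R$; $12\cdots k$ is the identity permutation of length $k$. -}

module Defs where

open import Data.Nat using (ℕ; zero; suc; _∸_) renaming (_<_ to _<ℕ_)
open import Data.Integer using (ℤ; +_; 0ℤ; 1ℤ; _+_; _*_)
open import Data.Fin using (Fin; toℕ) renaming (_<_ to _<ᶠ_)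
open import Data.Vec using (Vec; lookup)
open import Data.List using (List; foldr; map; upTo; length)
import Data.List as List
open import Data.List.Relation.Unary.Unique.Propositional using (Unique)
open import Data.List.Membership.Propositional using (_∈_)
open import Data.Product using (Σ; _×_)
open import Function.Bundles using (_⇔_)
open import Relation.Binary.PropositionalEquality using (_≡_)

PS : Set
PS = ℕ → ℤ

sumℤ : List ℤ → ℤ
sumℤ = foldr _+_ 0ℤ

zeroPS : PS
zeroPS _ = 0ℤ

onePS : PS
onePS zero    = 1ℤ
onePS (suc _) = 0ℤ

xPS : PS
xPS (suc zero) = 1ℤ
xPS _          = 0ℤ

_⊕_ : PS → PS → PS
(f ⊕ g) n = f n + g n

_⊛_ : PS → PS → PS
(f ⊛ g) n = sumℤ (map (λ i → f i * g (n ∸ i)) (upTo (suc n)))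

_^ᴾ_ : PS → ℕ → PS
f ^ᴾ zero  = onePS
f ^ᴾ suc m = f ⊛ (f ^ᴾ m)

-- For h with zero constant term, 1/(1 - h) = Σ_{m ≥ 0} h^m;
-- the coefficient of x^n only receives contributions from m ≤ n.
geomPS : PS → PS
geomPS h n = sumℤ (map (λ m → (h ^ᴾ m) n) (upTo (suc n)))

-- K_0 = 0,  K_j = x / (1 - x - K_{j-1}) = x · 1/(1 - (x + K_{j-1}))
K : ℕ → PS
K zero    = zeroPS
K (suc j) = xPS ⊛ geomPS (xPS ⊕ K j)

-- A permutation of length n in one-line notation: a vector of n entries
-- from Fin n (values 0..n-1) with pairwise distinct entries.
IsPerm : {n : ℕ} → Vec (Fin n) n → Set
IsPerm {n} σ = (i j : Fin n) → lookup σ i ≡ lookup σ j → i ≡ j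

Contains : {n : ℕ} → List ℕ → Vec (Fin n) n → Set
Contains {n} p σ =
  Σ (Fin (length p) → Fin n) λ f →
    ((i j : Fin (length p)) → i <ᶠ j → f i <ᶠ f j) ×
    ((i j : Fin (length p)) →
       (List.lookup p i <ℕ List.lookup p j) ⇔ (lookup σ (f i) <ᶠ lookup σ (f j)))

Avoids : {n : ℕ} → List ℕ → Vec (Fin n) n → Set
Avoids p σ = Contains p σ → ⊥'
  where open import Data.Empty renaming (⊥ to ⊥')

AvoidsAll : {n : ℕ} → List (List ℕ) → Vec (Fin n) n → Set
AvoidsAll R σ = All (λ p → Avoids p σ) R
  where open import Data.List.Relation.Unary.All using (All)

InS : (n : ℕ) → List (List ℕ) → Vec (Fin n) n → Set
InS n R σ = IsPerm σ × AvoidsAll R σ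

CardS : (n : ℕ) → List (List ℕ) → ℕ → Set
CardS n R c =
  Σ (List (Vec (Fin n) n)) λ L →
    Unique L × ((σ : Vec (Fin n) n) → (σ ∈ L) ⇔ InS n R σ) × length L ≡ c

idPat : ℕ → List ℕ
idPat k = map suc (upTo k)

R5 : ℕ → List (List ℕ)
R5 k = (1 List.∷ 2 List.∷ 4 List.∷ 3 List.∷ List.[])
     List.∷ (2 List.∷ 1 List.∷ 4 List.∷ 3 List.∷ List.[])
     List.∷ idPat k
     List.∷ List.[]

-- In a permutation avoiding 1243 and 2143, every entry to the left of the maximum n, except the
-- smallest of them, exceeds every entry to its right: otherwise that entry, the left minimum, n and
-- the smaller right entry would form a 1243 or a 2143.  Hence such a permutation is either n β, or
-- it splits at the maximum into a block α (the left part, its minimum included) avoiding 12⋯k-1 and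
-- a block ρ (the left minimum followed by the right part) avoiding 12⋯k, and conversely every such
-- pair glues back.  Writing Eₖ(x) for the generating function, this gives
-- Eₖ = 1 + x Eₖ + (Eₖ₋₁ - 1)(Eₖ - 1), i.e. Eₖ - 1 = x / (1 - x - (Eₖ₋₁ - 1)), so Eₖ = 1 + Kₖ₋₁.
module Submission where

open import Defs
open import Data.Nat using (ℕ; _≤_; _∸_)
open import Data.Integer using (+_)
open import Data.Product using (Σ; _×_)
open import Relation.Binary.PropositionalEquality using (_≡_)

module PowerSeries where

  open import Data.Integer using (ℤ; 0ℤ; 1ℤ; _+_; _*_)
  open import Data.Integer.Properties
  open import Data.List using (map; applyUpTo)
  open import Data.Nat as ℕ using (zero; suc; _<_; z≤n; s≤s)
  import Data.Nat.Properties as ℕ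
  open import Function using (_∘_)
  open import Relation.Binary.PropositionalEquality
  open import Algebra.Properties.CommutativeSemigroup +-commutativeSemigroup using (interchange)
  open ≡-Reasoning

  ∑ : ℕ → (ℕ → ℤ) → ℤ
  ∑ zero    f = 0ℤ
  ∑ (suc n) f = f 0 + ∑ n (f ∘ suc)

  sumℤ-applyUpTo : ∀ n (g : ℕ → ℕ) (f : ℕ → ℤ) → sumℤ (map f (applyUpTo g n)) ≡ ∑ n (f ∘ g)
  sumℤ-applyUpTo zero    g f = refl
  sumℤ-applyUpTo (suc n) g f = cong (_+_ (f (g 0))) (sumℤ-applyUpTo n (g ∘ suc) f)

  ∑-cong : ∀ n {f g : ℕ → ℤ} → (∀ i → i < n → f i ≡ g i) → ∑ n f ≡ ∑ n g
  ∑-cong zero    f≡g = refl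
  ∑-cong (suc n) f≡g = cong₂ _+_ (f≡g 0 (s≤s z≤n)) (∑-cong n (λ i i<n → f≡g (suc i) (s≤s i<n)))

  ∑-zero : ∀ n {f : ℕ → ℤ} → (∀ i → i < n → f i ≡ 0ℤ) → ∑ n f ≡ 0ℤ
  ∑-zero zero    f≡0 = refl
  ∑-zero (suc n) f≡0 = cong₂ _+_ (f≡0 0 (s≤s z≤n)) (∑-zero n (λ i i<n → f≡0 (suc i) (s≤s i<n)))

  ∑-split : ∀ m n (f : ℕ → ℤ) → ∑ (m ℕ.+ n) f ≡ ∑ m f + ∑ n (λ i → f (m ℕ.+ i))
  ∑-split zero    n f = sym (+-identityˡ _)
  ∑-split (suc m) n f = trans (cong (_+_ (f 0)) (∑-split m n (f ∘ suc))) (sym (+-assoc (f 0) _ _))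

  ∑-distrib-+ : ∀ n (f g : ℕ → ℤ) → ∑ n (λ i → f i + g i) ≡ ∑ n f + ∑ n g
  ∑-distrib-+ zero    f g = refl
  ∑-distrib-+ (suc n) f g = trans (cong (_+_ (f 0 + g 0)) (∑-distrib-+ n (f ∘ suc) (g ∘ suc)))
                                  (interchange (f 0) (g 0) _ _)

  *-distribˡ-∑ : ∀ n c (f : ℕ → ℤ) → c * ∑ n f ≡ ∑ n (λ i → c * f i)
  *-distribˡ-∑ zero    c f = *-zeroʳ c
  *-distribˡ-∑ (suc n) c f = trans (*-distribˡ-+ c (f 0) _)
                                   (cong (_+_ (c * f 0)) (*-distribˡ-∑ n c (f ∘ suc)))

  ∑-comm : ∀ m n (f : ℕ → ℕ → ℤ) → ∑ m (λ a → ∑ n (f a)) ≡ ∑ n (λ b → ∑ m (λ a → f a b))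
  ∑-comm zero    n f = sym (∑-zero n (λ _ _ → refl))
  ∑-comm (suc m) n f = trans (cong (_+_ (∑ n (f 0))) (∑-comm m n (f ∘ suc)))
                             (sym (∑-distrib-+ n (f 0) _))

  ⊛-coeff : ∀ (f g : PS) n → (f ⊛ g) n ≡ ∑ (suc n) (λ i → f i * g (n ∸ i))
  ⊛-coeff f g n = sumℤ-applyUpTo (suc n) (λ i → i) (λ i → f i * g (n ∸ i))

  x⊛-suc : ∀ g n → (xPS ⊛ g) (suc n) ≡ g n
  x⊛-suc g n = begin
    (xPS ⊛ g) (suc n)                                   ≡⟨ ⊛-coeff xPS g (suc n) ⟩
    0ℤ + (1ℤ * g n + ∑ n (λ i → 0ℤ * g (n ∸ suc i)))    ≡⟨ +-identityˡ _ ⟩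
    1ℤ * g n + ∑ n (λ i → 0ℤ * g (n ∸ suc i))           ≡⟨ cong₂ _+_ (*-identityˡ (g n))
                                                                      (∑-zero n (λ _ _ → refl)) ⟩
    g n + 0ℤ                                            ≡⟨ +-identityʳ (g n) ⟩
    g n                                                 ∎

  module Geometric (h : PS) (h₀≡0 : h 0 ≡ 0ℤ) where

    ^ᴾ-vanishes : ∀ m t → t < m → (h ^ᴾ m) t ≡ 0ℤ
    ^ᴾ-vanishes (suc m) t (s≤s t≤m) = begin
      (h ^ᴾ suc m) t
        ≡⟨ ⊛-coeff h (h ^ᴾ m) t ⟩
      h 0 * (h ^ᴾ m) t + ∑ t (λ i → h (suc i) * (h ^ᴾ m) (t ∸ suc i))
        ≡⟨ cong₂ _+_ (cong (_* (h ^ᴾ m) t) h₀≡0) (∑-zero t lower) ⟩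
      0ℤ
        ∎
      where
      lower : ∀ i → i < t → h (suc i) * (h ^ᴾ m) (t ∸ suc i) ≡ 0ℤ
      lower i i<t = trans (cong (h (suc i) *_) (^ᴾ-vanishes m (t ∸ suc i)
                            (ℕ.<-≤-trans (ℕ.∸-monoʳ-< (s≤s z≤n) i<t) t≤m)))
                          (*-zeroʳ (h (suc i)))

    geomPS-truncate : ∀ t d → ∑ (suc t ℕ.+ d) (λ m → (h ^ᴾ m) t) ≡ geomPS h t
    geomPS-truncate t d = begin
      ∑ (suc t ℕ.+ d) (λ m → (h ^ᴾ m) t)
        ≡⟨ ∑-split (suc t) d (λ m → (h ^ᴾ m) t) ⟩
      ∑ (suc t) (λ m → (h ^ᴾ m) t) + ∑ d (λ i → (h ^ᴾ (suc t ℕ.+ i)) t)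
        ≡⟨ cong (_+_ (∑ (suc t) (λ m → (h ^ᴾ m) t)))
                (∑-zero d (λ i _ → ^ᴾ-vanishes (suc t ℕ.+ i) t (s≤s (ℕ.m≤m+n t i)))) ⟩
      ∑ (suc t) (λ m → (h ^ᴾ m) t) + 0ℤ
        ≡⟨ +-identityʳ _ ⟩
      ∑ (suc t) (λ m → (h ^ᴾ m) t)
        ≡⟨ sumℤ-applyUpTo (suc t) (λ m → m) (λ m → (h ^ᴾ m) t) ⟨
      geomPS h t
        ∎

    -- The coefficientwise form of  G = 1 + h G  for  G = 1/(1 - h).
    geomPS-suc : ∀ n → geomPS h (suc n) ≡ ∑ (suc n) (λ i → h (suc i) * geomPS h (n ∸ i))
    geomPS-suc n = begin
      geomPS h (suc n)
        ≡⟨ sumℤ-applyUpTo (suc (suc n)) (λ m → m) (λ m → (h ^ᴾ m) (suc n)) ⟩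
      0ℤ + ∑ (suc n) (λ m → (h ^ᴾ suc m) (suc n))
        ≡⟨ +-identityˡ _ ⟩
      ∑ (suc n) (λ m → (h ^ᴾ suc m) (suc n))
        ≡⟨ ∑-cong (suc n) (λ m _ → ⊛-coeff h (h ^ᴾ m) (suc n)) ⟩
      ∑ (suc n) (λ m → ∑ (suc (suc n)) (λ i → h i * (h ^ᴾ m) (suc n ∸ i)))
        ≡⟨ ∑-comm (suc n) (suc (suc n)) (λ m i → h i * (h ^ᴾ m) (suc n ∸ i)) ⟩
      ∑ (suc (suc n)) (λ i → ∑ (suc n) (λ m → h i * (h ^ᴾ m) (suc n ∸ i)))
        ≡⟨ ∑-cong (suc (suc n)) (λ i _ → *-distribˡ-∑ (suc n) (h i) (λ m → (h ^ᴾ m) (suc n ∸ i))) ⟨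
      h 0 * ∑ (suc n) (λ m → (h ^ᴾ m) (suc n)) + rest
        ≡⟨ cong (λ c → c * ∑ (suc n) (λ m → (h ^ᴾ m) (suc n)) + rest) h₀≡0 ⟩
      0ℤ + rest
        ≡⟨ +-identityˡ rest ⟩
      rest
        ≡⟨ ∑-cong (suc n) (λ i i≤n → cong (h (suc i) *_) (truncate i (ℕ.m∸n≤m n i))) ⟩
      ∑ (suc n) (λ i → h (suc i) * geomPS h (n ∸ i))
        ∎
      where
      rest : ℤ
      rest = ∑ (suc n) (λ i → h (suc i) * ∑ (suc n) (λ m → (h ^ᴾ m) (n ∸ i)))
      truncate : ∀ i → n ∸ i ℕ.≤ n → ∑ (suc n) (λ m → (h ^ᴾ m) (n ∸ i)) ≡ geomPS h (n ∸ i)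
      truncate i le = trans (cong (λ M → ∑ M (λ m → (h ^ᴾ m) (n ∸ i))) (sym (cong suc (ℕ.m+[n∸m]≡n le))))
                            (geomPS-truncate (n ∸ i) (n ∸ (n ∸ i)))

  E : ℕ → PS
  E j = onePS ⊕ K j

  E-suc-suc : ∀ j n → E (suc j) (suc n) ≡ geomPS (xPS ⊕ K j) n
  E-suc-suc j n = trans (+-identityˡ _) (x⊛-suc (geomPS (xPS ⊕ K j)) n)

  K-constant : ∀ j → K j 0 ≡ 0ℤ
  K-constant zero    = refl
  K-constant (suc j) = refl

  E-recurrence : ∀ j n → E (suc j) (suc n) ≡ E (suc j) n + ∑ n (λ i → E j (suc i) * E (suc j) (n ∸ i))
  E-recurrence j zero    = refl
  E-recurrence j (suc n) = begin
    E (suc j) (suc (suc n))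
      ≡⟨ E-suc-suc j (suc n) ⟩
    G (suc n)
      ≡⟨ geomPS-suc n ⟩
    ∑ (suc n) (λ i → (xPS (suc i) + K j (suc i)) * G (n ∸ i))
      ≡⟨ ∑-cong (suc n) (λ i _ → *-distribʳ-+ (G (n ∸ i)) (xPS (suc i)) (K j (suc i))) ⟩
    ∑ (suc n) (λ i → xPS (suc i) * G (n ∸ i) + K j (suc i) * G (n ∸ i))
      ≡⟨ ∑-distrib-+ (suc n) (λ i → xPS (suc i) * G (n ∸ i)) (λ i → K j (suc i) * G (n ∸ i)) ⟩
    ∑ (suc n) (λ i → xPS (suc i) * G (n ∸ i)) + ∑ (suc n) (λ i → K j (suc i) * G (n ∸ i))
      ≡⟨ cong₂ _+_ x-part
                   (∑-cong (suc n) (λ i i≤n → cong₂ _*_ (sym (+-identityˡ (K j (suc i))))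
                                                          (shift i (ℕ.≤-pred i≤n)))) ⟩
    E (suc j) (suc n) + ∑ (suc n) (λ i → E j (suc i) * E (suc j) (suc n ∸ i))
      ∎
    where
    open Geometric (xPS ⊕ K j) (cong (_+_ 0ℤ) (K-constant j))
    G : PS
    G = geomPS (xPS ⊕ K j)
    x-part : ∑ (suc n) (λ i → xPS (suc i) * G (n ∸ i)) ≡ E (suc j) (suc n)
    x-part = begin
      ∑ (suc n) (λ i → xPS (suc i) * G (n ∸ i))         ≡⟨ +-identityˡ _ ⟨
      0ℤ + ∑ (suc n) (λ i → xPS (suc i) * G (n ∸ i))    ≡⟨ ⊛-coeff xPS G (suc n) ⟨
      (xPS ⊛ G) (suc n)                                 ≡⟨ +-identityˡ _ ⟨
      E (suc j) (suc n)                                 ∎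
    shift : ∀ i → i ℕ.≤ n → G (n ∸ i) ≡ E (suc j) (suc n ∸ i)
    shift i i≤n = trans (sym (E-suc-suc j (n ∸ i))) (cong (E (suc j)) (sym (ℕ.+-∸-assoc 1 i≤n)))

module Avoiders where

  open import Data.Nat using (zero; suc; _+_; _*_; _<_; z≤n; s≤s; z<s; s<s; _≟_; _<?_; _≤?_; pred)
  open import Data.Nat.Properties
  open import Data.Fin as Fin using (Fin; toℕ; fromℕ<; punchOut; #_) renaming (_<_ to _<ᶠ_)
  import Data.Fin.Properties as Finₚ
  open import Data.Vec as Vec using (Vec; lookup; tabulate)
  open import Data.Vec.Properties using (lookup∘tabulate; tabulate∘lookup; tabulate-cong)
  open import Data.List using (List; []; _∷_; map; _++_; concatMap; cartesianProductWith; upTo; applyUpTo; length)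
  import Data.List as List
  open import Data.List.Properties using (length-++; length-map; length-upTo)
  open import Data.List.Extrema.Nat using (argmin; argmin-all; f[argmin]≤f[xs])
  open import Data.List.Membership.Propositional using (_∈_; find; lose)
  open import Data.List.Membership.Propositional.Properties
    using (∈-map⁺; ∈-map⁻; ∈-++⁺ˡ; ∈-++⁺ʳ; ∈-++⁻; ∈-concatMap⁺; ∈-concatMap⁻; ∈-applyUpTo⁺; ∈-applyUpTo⁻;
           ∈-cartesianProductWith⁺; ∈-cartesianProductWith⁻; ∈-lookup)
  open import Data.List.Relation.Unary.Any using (here; there)
  open import Data.List.Relation.Unary.All as All using (All; all?)
  import Data.List.Relation.Unary.All.Properties as Allₚ
  import Data.List.Relation.Unary.AllPairs as AllPairs
  import Data.List.Relation.Unary.AllPairs.Properties as AllPairsₚ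
  open import Data.List.Relation.Unary.Unique.Propositional using (Unique)
  import Data.List.Relation.Unary.Unique.Propositional.Properties as Unique
  open import Data.List.Relation.Binary.Disjoint.Propositional using (Disjoint)
  open import Data.Product using (∃-syntax; _,_; proj₁; proj₂)
  open import Data.Sum using (_⊎_; inj₁; inj₂; [_,_]′)
  open import Data.Unit using (⊤; tt)
  open import Data.Empty using (⊥; ⊥-elim)
  open import Relation.Nullary using (¬_; yes; no)
  open import Relation.Nullary.Decidable using (True; toWitness; _×-dec_)
  open import Relation.Binary using (tri<; tri≈; tri>)
  open import Relation.Binary.PropositionalEquality
  open import Function using (_∘_; id)
  open import Function.Bundles using (_⇔_; mk⇔; Equivalence)

  Bounded : ℕ → (ℕ → ℕ) → Set
  Bounded n f = ∀ i → i < n → f i < n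

  InjectiveBelow : ℕ → (ℕ → ℕ) → Set
  InjectiveBelow n f = ∀ {i j} → i < n → j < n → f i ≡ f j → i ≡ j

  module Monotone {A : Set} {D : A → Set} (f g : A → ℕ)
                  (mono : ∀ {x y} → D x → D y → f x < f y → g x < g y) where

    reflects : ∀ {x y} → D x → D y → (f x ≡ f y → g x ≡ g y) → g x < g y → f x < f y
    reflects {x} {y} dx dy cong-g gx<gy with <-cmp (f x) (f y)
    ... | tri< fx<fy _ _ = fx<fy
    ... | tri≈ _ fx≡fy _ = ⊥-elim (<-irrefl (cong-g fx≡fy) gx<gy)
    ... | tri> _ _ fy<fx = ⊥-elim (<-asym gx<gy (mono dy dx fy<fx))

    injective : ∀ {x y} → D x → D y → g x ≡ g y → f x ≡ f y
    injective {x} {y} dx dy gx≡gy with <-cmp (f x) (f y)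
    ... | tri< fx<fy _ _ = ⊥-elim (<-irrefl gx≡gy (mono dx dy fx<fy))
    ... | tri≈ _ fx≡fy _ = fx≡fy
    ... | tri> _ _ fy<fx = ⊥-elim (<-irrefl (sym gx≡gy) (mono dy dx fy<fx))

  pigeonhole : ∀ {m n} (g : ℕ → ℕ) → (∀ t → t < m → g t < n) → InjectiveBelow m g → m ≤ n
  pigeonhole {m} {n} g g<n g-inj with m ≤? n
  ... | yes m≤n = m≤n
  ... | no m≰n with Finₚ.pigeonhole (≰⇒> m≰n) (λ x → fromℕ< (g<n (toℕ x) (Finₚ.toℕ<n x)))
  ...   | x , y , x<y , gx≡gy =
    ⊥-elim (<⇒≢ x<y (g-inj (Finₚ.toℕ<n x) (Finₚ.toℕ<n y) (Finₚ.fromℕ<-injective _ _ _ _ gx≡gy)))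

  bounded-injective⇒surjective : ∀ {n f v} → Bounded n f → InjectiveBelow n f → v < n →
                                 ∃[ p ] p < n × f p ≡ v
  bounded-injective⇒surjective {suc n} {f} {v} f<n f-inj v<n with Finₚ.any? (λ x → f (toℕ x) ≟ v)
  ... | yes (x , fx≡v) = toℕ x , Finₚ.toℕ<n x , fx≡v
  ... | no missed = ⊥-elim collision
    where
    v≢f : ∀ x → fromℕ< v<n ≢ fromℕ< (f<n (toℕ x) (Finₚ.toℕ<n x))
    v≢f x v≡fx = missed (x , sym (Finₚ.fromℕ<-injective _ _ _ _ v≡fx))
    collision : ⊥
    collision with Finₚ.pigeonhole ≤-refl (λ x → punchOut (v≢f x))
    ... | x , y , x<y , same = <⇒≢ x<y (f-inj (Finₚ.toℕ<n x) (Finₚ.toℕ<n y)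
            (Finₚ.fromℕ<-injective _ _ _ _ (Finₚ.punchOut-injective (v≢f x) (v≢f y) same)))

  -- 1243 and 2143 differ only in the order of their first two entries, so one record covers both:
  -- positions i < j < k < l with f i , f j < f l < f k.
  record Occ1243∨2143 (n : ℕ) (f : ℕ → ℕ) : Set where
    constructor occ
    field
      {i j k l} : ℕ
      i<j : i < j
      j<k : j < k
      k<l : k < l
      l<n : l < n
      fi<fl : f i < f l
      fj<fl : f j < f l
      fl<fk : f l < f k

    k<n : k < n
    k<n = <-trans k<l l<n

    j<n : j < n
    j<n = <-trans j<k k<n

    i<n : i < n
    i<n = <-trans i<j j<n

  record IncreasingSubseq (r n : ℕ) (f : ℕ → ℕ) : Set where
    constructor incr
    field
      pos : ℕ → ℕ
      pos<n : ∀ {t} → t < r → pos t < n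
      increasing : ∀ {s t} → s < t → t < r → pos s < pos t × f (pos s) < f (pos t)

  -- A permutation of length n is modelled by a function ℕ → ℕ of which only the values on [0, n)
  -- matter.  Avoider j n f: f is a permutation in 𝔖ₙ(1243, 2143, 12⋯(j+1)), indexed like Kⱼ.
  record Avoider (j n : ℕ) (f : ℕ → ℕ) : Set where
    field
      bounded : Bounded n f
      injective : InjectiveBelow n f
      no-1243∨2143 : ¬ Occ1243∨2143 n f
      no-increasing : ¬ IncreasingSubseq (suc j) n f

  open Avoider public

  inc-init : ∀ {r n f} → IncreasingSubseq (suc r) n f → IncreasingSubseq r n f
  inc-init (incr pos pos<n increasing) =
    incr pos (pos<n ∘ m<n⇒m<1+n) (λ s<t t<r → increasing s<t (m<n⇒m<1+n t<r))

  inc-snoc : ∀ {r n f z} (s : IncreasingSubseq r n f) → z < n →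
             (∀ {t} → t < r → IncreasingSubseq.pos s t < z × f (IncreasingSubseq.pos s t) < f z) →
             IncreasingSubseq (suc r) n f
  inc-snoc {r} {n} {f} {z} (incr pos pos<n increasing) z<n below = incr pos′ pos′<n increasing′
    where
    pos′ : ℕ → ℕ
    pos′ t with t <? r
    ... | yes _ = pos t
    ... | no  _ = z
    pos′<n : ∀ {t} → t < suc r → pos′ t < n
    pos′<n {t} _ with t <? r
    ... | yes t<r = pos<n t<r
    ... | no  _   = z<n
    increasing′ : ∀ {s t} → s < t → t < suc r → pos′ s < pos′ t × f (pos′ s) < f (pos′ t)
    increasing′ {s} {t} s<t t≤r with s <? r | t <? r
    ... | yes _   | yes t<r = increasing s<t t<r
    ... | yes s<r | no  _   = below s<r
    ... | no  s≮r | yes t<r = ⊥-elim (s≮r (<-trans s<t t<r))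
    ... | no  s≮r | no  _   = ⊥-elim (s≮r (<-≤-trans s<t (≤-pred t≤r)))

  record Embedding (D : ℕ → Set) (n : ℕ) (g f : ℕ → ℕ) : Set where
    field
      φ : ℕ → ℕ
      φ-mono : ∀ {x y} → D x → D y → x < y → φ x < φ y
      φ<n : ∀ {x} → D x → φ x < n
      φ-order : ∀ {x y} → D x → D y → g x < g y → f (φ x) < f (φ y)

  module _ {D : ℕ → Set} {n : ℕ} {g f : ℕ → ℕ} (e : Embedding D n g f) where
    open Embedding e

    occ-embed : ∀ {m} (o : Occ1243∨2143 m g) → let open Occ1243∨2143 o in
                D i → D j → D k → D l → Occ1243∨2143 n f
    occ-embed (occ i<j j<k k<l _ fi<fl fj<fl fl<fk) di dj dk dl =
      occ (φ-mono di dj i<j) (φ-mono dj dk j<k) (φ-mono dk dl k<l) (φ<n dl)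
          (φ-order di dl fi<fl) (φ-order dj dl fj<fl) (φ-order dl dk fl<fk)

    inc-embed : ∀ {r m} (s : IncreasingSubseq r m g) → (∀ {t} → t < r → D (IncreasingSubseq.pos s t)) →
                IncreasingSubseq r n f
    inc-embed (incr pos _ increasing) d = incr (φ ∘ pos) (φ<n ∘ d) λ s<t t<r →
      let s<r = <-trans s<t t<r in
      φ-mono (d s<r) (d t<r) (proj₁ (increasing s<t t<r)) , φ-order (d s<r) (d t<r) (proj₂ (increasing s<t t<r))

  module _ {m n : ℕ} {g f : ℕ → ℕ} (e : Embedding (_< m) n g f) where

    occ-embed< : Occ1243∨2143 m g → Occ1243∨2143 n f
    occ-embed< o = occ-embed e o i<n j<n k<n l<n
      where open Occ1243∨2143 o

    inc-embed< : ∀ {r} → IncreasingSubseq r m g → IncreasingSubseq r n f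
    inc-embed< s = inc-embed e s (IncreasingSubseq.pos<n s)

    avoider-embed : ∀ {j} → Bounded m g → InjectiveBelow m g → Avoider j n f → Avoider j m g
    avoider-embed g<m g-inj f-av = record
      { bounded = g<m
      ; injective = g-inj
      ; no-1243∨2143 = no-1243∨2143 f-av ∘ occ-embed<
      ; no-increasing = no-increasing f-av ∘ inc-embed<
      }

  avoider-cong : ∀ {j n f g} → (∀ i → i < n → f i ≡ g i) → Avoider j n f → Avoider j n g
  avoider-cong {n = n} {f} {g} f≗g f-av = avoider-embed identity g<n g-inj f-av
    where
    identity : Embedding (_< n) n g f
    identity = record
      { φ = id ; φ-mono = λ _ _ x<y → x<y ; φ<n = id
      ; φ-order = λ {x} {y} x<n y<n → subst₂ _<_ (sym (f≗g x x<n)) (sym (f≗g y y<n)) }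
    g<n : Bounded n g
    g<n i i<n = subst (_< n) (f≗g i i<n) (bounded f-av i i<n)
    g-inj : InjectiveBelow n g
    g-inj {i} {j} i<n j<n gi≡gj = injective f-av i<n j<n (trans (f≗g i i<n) (trans gi≡gj (sym (f≗g j j<n))))

  avoider-empty : ∀ {j f} → Avoider j 0 f
  avoider-empty = record
    { bounded = λ _ ()
    ; injective = λ ()
    ; no-1243∨2143 = λ o → n≮0 (Occ1243∨2143.l<n o)
    ; no-increasing = λ s → n≮0 (IncreasingSubseq.pos<n s (s≤s z≤n))
    }

  no-avoider₀ : ∀ {n f} → ¬ Avoider 0 (suc n) f
  no-avoider₀ f-av = no-increasing f-av
    (incr (λ _ → 0) (λ _ → s≤s z≤n) λ { s<t (s≤s t≤0) → ⊥-elim (n≮0 (<-≤-trans s<t t≤0)) })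

  max-position : ∀ {j N f} → Avoider j (suc N) f → ∃[ p ] p < suc N × f p ≡ N
  max-position f-av = bounded-injective⇒surjective (bounded f-av) (injective f-av) ≤-refl

  prepend : ℕ → (ℕ → ℕ) → ℕ → ℕ
  prepend N β zero    = N
  prepend N β (suc p) = β p

  prepend-avoider : ∀ {j N β} → Avoider (suc j) N β → Avoider (suc j) (suc N) (prepend N β)
  prepend-avoider {j} {N} {β} β-av = record
    { bounded = σ<1+N
    ; injective = σ-inj
    ; no-1243∨2143 = no-occ
    ; no-increasing = no-inc
    }
    where
    σ : ℕ → ℕ
    σ = prepend N β

    σ<1+N : Bounded (suc N) σ
    σ<1+N zero    _         = ≤-refl
    σ<1+N (suc p) (s≤s p<N) = m<n⇒m<1+n (bounded β-av p p<N)

    σ-inj : InjectiveBelow (suc N) σ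
    σ-inj {zero}  {zero}  _         _         _    = refl
    σ-inj {zero}  {suc y} _         (s≤s y<N) N≡βy = ⊥-elim (<-irrefl (sym N≡βy) (bounded β-av y y<N))
    σ-inj {suc x} {zero}  (s≤s x<N) _         βx≡N = ⊥-elim (<-irrefl βx≡N (bounded β-av x x<N))
    σ-inj {suc x} {suc y} (s≤s x<N) (s≤s y<N) βx≡βy = cong suc (injective β-av x<N y<N βx≡βy)

    Tail : ℕ → Set
    Tail p = 0 < p × p < suc N

    into-β : Embedding Tail N σ β
    into-β = record
      { φ = pred
      ; φ-mono = λ { {suc x} {suc y} _ _ (s≤s x<y) → x<y }
      ; φ<n = λ { {suc x} (_ , s≤s x<N) → x<N }
      ; φ-order = λ { {suc x} {suc y} _ _ βx<βy → βx<βy }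
      }

    -- σ 0 = N exceeds every later entry.
    N-first : ∀ {p q} → p < q → q < suc N → σ p < σ q → 0 < p
    N-first {zero} {q} _ q<1+N N<σq = ⊥-elim (<-irrefl refl (<-≤-trans N<σq (≤-pred (σ<1+N q q<1+N))))
    N-first {suc p} _ _ _ = s≤s z≤n

    no-occ : ¬ Occ1243∨2143 (suc N) σ
    no-occ o = no-1243∨2143 β-av (occ-embed into-β o (tail ≤-refl i<n) (tail (<⇒≤ i<j) j<n)
                                    (tail (<⇒≤ i<k) k<n) (tail (<⇒≤ (<-trans i<k k<l)) l<n))
      where
      open Occ1243∨2143 o
      i<k : i < k
      i<k = <-trans i<j j<k
      tail : ∀ {p} → i ≤ p → p < suc N → Tail p
      tail i≤p p<1+N = <-≤-trans (N-first (<-trans i<k k<l) l<n fi<fl) i≤p , p<1+N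

    no-inc : ¬ IncreasingSubseq (suc (suc j)) (suc N) σ
    no-inc s = no-increasing β-av (inc-embed into-β s tail)
      where
      open IncreasingSubseq s
      0<pos₀ : 0 < pos 0
      0<pos₀ = N-first (proj₁ (increasing (s≤s z≤n) (s≤s (s≤s z≤n)))) (pos<n (s≤s (s≤s z≤n)))
                       (proj₂ (increasing (s≤s z≤n) (s≤s (s≤s z≤n))))
      tail : ∀ {t} → t < suc (suc j) → Tail (pos t)
      tail {zero}  t<r = 0<pos₀ , pos<n t<r
      tail {suc t} t<r = <-trans 0<pos₀ (proj₁ (increasing (s≤s z≤n) t<r)) , pos<n t<r

  tail-avoider : ∀ {j N f} → Avoider j (suc N) f → f 0 ≡ N → Avoider j N (f ∘ suc)
  tail-avoider {j} {N} {f} f-av f0≡N = avoider-embed shift tail<N tail-inj f-av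
    where
    shift : Embedding (_< N) (suc N) (f ∘ suc) f
    shift = record { φ = suc ; φ-mono = λ _ _ → s≤s ; φ<n = s≤s ; φ-order = λ _ _ lt → lt }
    tail<N : Bounded N (f ∘ suc)
    tail<N p p<N = ≤∧≢⇒< (≤-pred (bounded f-av (suc p) (s≤s p<N)))
                         (λ fp≡N → 1+n≢0 (injective f-av (s≤s p<N) (s≤s z≤n) (trans fp≡N (sym f0≡N))))
    tail-inj : InjectiveBelow N (f ∘ suc)
    tail-inj x<N y<N e = suc-injective (injective f-av (s≤s x<N) (s≤s y<N) e)

  lift : ℕ → ℕ → ℕ → ℕ
  lift r b zero    = r
  lift r b (suc y) = y + b

  lower : ℕ → ℕ → ℕ
  lower b v with v <? b
  ... | yes _ = 0
  ... | no  _ = suc (v ∸ b)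

  lower-< : ∀ {b v} → v < b → lower b v ≡ 0
  lower-< {b} {v} v<b with v <? b
  ... | yes _   = refl
  ... | no  v≮b = ⊥-elim (v≮b v<b)

  lower-≥ : ∀ {b v} → b ≤ v → lower b v ≡ suc (v ∸ b)
  lower-≥ {b} {v} b≤v with v <? b
  ... | yes v<b = ⊥-elim (<⇒≱ v<b b≤v)
  ... | no  _   = refl

  lower-lift : ∀ {r b} u → r < b → lower b (lift r b u) ≡ u
  lower-lift zero    r<b = lower-< r<b
  lower-lift {b = b} (suc y) _ = trans (lower-≥ (m≤n+m b y)) (cong suc (m+n∸n≡m y b))

  lift-lower : ∀ {r b v} → b ≤ v → lift r b (lower b v) ≡ v
  lift-lower {r} {b} b≤v = trans (cong (lift r b) (lower-≥ b≤v)) (m∸n+n≡m b≤v)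

  lift-mono : ∀ {r b u u′} → r < b → u < u′ → lift r b u < lift r b u′
  lift-mono {b = b} {zero}  {suc y′} r<b _         = <-≤-trans r<b (m≤n+m b y′)
  lift-mono {b = b} {suc y} {suc y′} _   (s≤s y<y′) = +-monoˡ-< b y<y′

  lower-mono : ∀ {b v w} → v < w → b ≤ w → lower b v < lower b w
  lower-mono {b} {v} {w} v<w b≤w with v <? b
  ... | yes _   = subst (0 <_) (sym (lower-≥ b≤w)) (s≤s z≤n)
  ... | no  v≮b = subst (suc (v ∸ b) <_) (sym (lower-≥ b≤w)) (s≤s (∸-monoˡ-< v<w (≮⇒≥ v≮b)))

  -- σ = glue a b N α ρ has its maximum N at position a.  Left of it sits a copy of α in which the
  -- entry 0 stands for ρ 0 and suc y for y + b; right of it sits the rest of ρ.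
  glue : (a b N : ℕ) (α ρ : ℕ → ℕ) → ℕ → ℕ
  glue a b N α ρ p with <-cmp p a
  ... | tri< _ _ _ = lift (ρ 0) b (α p)
  ... | tri≈ _ _ _ = N
  ... | tri> _ _ _ = ρ (p ∸ a)

  module Glue (a b N : ℕ) (α ρ : ℕ → ℕ) where

    σ : ℕ → ℕ
    σ = glue a b N α ρ

    glue-left : ∀ {p} → p < a → σ p ≡ lift (ρ 0) b (α p)
    glue-left {p} p<a with <-cmp p a
    ... | tri< _ _ _   = refl
    ... | tri≈ _ p≡a _ = ⊥-elim (<-irrefl p≡a p<a)
    ... | tri> _ _ a<p = ⊥-elim (<-asym p<a a<p)

    glue-top : σ a ≡ N
    glue-top with <-cmp a a
    ... | tri< a<a _ _ = ⊥-elim (<-irrefl refl a<a)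
    ... | tri≈ _ _ _   = refl
    ... | tri> _ _ a<a = ⊥-elim (<-irrefl refl a<a)

    glue-right : ∀ {p} → a < p → σ p ≡ ρ (p ∸ a)
    glue-right {p} a<p with <-cmp p a
    ... | tri< p<a _ _ = ⊥-elim (<-asym p<a a<p)
    ... | tri≈ _ p≡a _ = ⊥-elim (<-irrefl (sym p≡a) a<p)
    ... | tri> _ _ _   = refl

  module _ {j a b N : ℕ} {α ρ : ℕ → ℕ} (α-av : Avoider j a α) (ρ-av : Avoider (suc j) b ρ)
           (0<a : 0 < a) (0<b : 0 < b) (a+b≡1+N : a + b ≡ suc N) where

    open Glue a b N α ρ

    private
      b≤N : b ≤ N
      b≤N = ≤-pred (subst (suc b ≤_) a+b≡1+N (+-monoˡ-≤ b 0<a))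

      p∸a<b : ∀ {p} → p < suc N → p ∸ a < b
      p∸a<b {p} p<1+N with a ≤? p
      ... | yes a≤p = subst (p ∸ a <_) (m+n∸m≡n a b) (∸-monoˡ-< (subst (p <_) (sym a+b≡1+N) p<1+N) a≤p)
      ... | no  a≰p = subst (_< b) (sym (m≤n⇒m∸n≡0 (<⇒≤ (≰⇒> a≰p)))) 0<b

      -- The positions of σ that carry entries of ρ: the zero of α, and everything right of a.
      Low : ℕ → Set
      Low p = (p < a × α p ≡ 0) ⊎ (a < p × p < suc N)

      data View (p : ℕ) : Set where
        low  : Low p → View p
        high : ∀ y → p < a → α p ≡ suc y → View p
        top  : p ≡ a → View p

      view : ∀ {p} → p < suc N → View p
      view {p} p<1+N with <-cmp p a
      ... | tri≈ _ p≡a _ = top p≡a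
      ... | tri> _ _ a<p = low (inj₂ (a<p , p<1+N))
      ... | tri< p<a _ _ with α p in αp
      ...   | zero  = low (inj₁ (p<a , αp))
      ...   | suc y = high y p<a αp

      σ-low : ∀ {p} → Low p → σ p ≡ ρ (p ∸ a)
      σ-low (inj₁ (p<a , αp≡0)) = trans (glue-left p<a) (trans (cong (lift (ρ 0) b) αp≡0)
                                    (cong ρ (sym (m≤n⇒m∸n≡0 (<⇒≤ p<a)))))
      σ-low (inj₂ (a<p , _))    = glue-right a<p

      low<1+N : ∀ {p} → Low p → p < suc N
      low<1+N (inj₁ (p<a , _)) = <-trans p<a (subst (a <_) a+b≡1+N (m<m+n a 0<b))
      low<1+N (inj₂ (_ , p<1+N)) = p<1+N

      σ-low<b : ∀ {p} → Low p → σ p < b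
      σ-low<b lp = subst (_< b) (sym (σ-low lp)) (bounded ρ-av _ (p∸a<b (low<1+N lp)))

      σ-high : ∀ {p y} → p < a → α p ≡ suc y → σ p ≡ y + b
      σ-high p<a αp≡1+y = trans (glue-left p<a) (cong (lift (ρ 0) b) αp≡1+y)

      b≤σ-high : ∀ {p y} → p < a → α p ≡ suc y → b ≤ σ p
      b≤σ-high {y = y} p<a αp≡1+y = subst (b ≤_) (sym (σ-high p<a αp≡1+y)) (m≤n+m b y)

      σ-high<N : ∀ {p y} → p < a → α p ≡ suc y → σ p < N
      σ-high<N {p} {y} p<a αp≡1+y = subst (_< N) (sym (σ-high p<a αp≡1+y))
        (≤-pred (subst (suc (suc y) + b ≤_) a+b≡1+N (+-monoˡ-≤ b (subst (_< a) αp≡1+y (bounded α-av p p<a)))))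

      σ-top : ∀ {p} → p ≡ a → σ p ≡ N
      σ-top refl = glue-top

      low-mono : ∀ {x y} → Low x → Low y → x < y → x ∸ a < y ∸ a
      low-mono (inj₁ (x<a , αx≡0)) (inj₁ (y<a , αy≡0)) x<y =
        ⊥-elim (<-irrefl (injective α-av x<a y<a (trans αx≡0 (sym αy≡0))) x<y)
      low-mono {y = y} (inj₁ (x<a , _)) (inj₂ (a<y , _)) _ =
        subst (_< y ∸ a) (sym (m≤n⇒m∸n≡0 (<⇒≤ x<a))) (m<n⇒0<n∸m a<y)
      low-mono (inj₂ (a<x , _)) (inj₁ (y<a , _)) x<y = ⊥-elim (<-asym a<x (<-trans x<y y<a))
      low-mono (inj₂ (a<x , _)) (inj₂ _) x<y = ∸-monoˡ-< x<y (<⇒≤ a<x)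

      later-low-is-right : ∀ {x y} → Low x → Low y → x < y → a < y
      later-low-is-right lx ly x<y = m∸n≢0⇒n<m (m<n⇒n≢0 (low-mono lx ly x<y))

      low-of-small : ∀ {p} → p < suc N → σ p < b → Low p
      low-of-small p<1+N σp<b with view p<1+N
      ... | low lp          = lp
      ... | high _ p<a αp   = ⊥-elim (<⇒≱ σp<b (b≤σ-high p<a αp))
      ... | top p≡a         = ⊥-elim (<⇒≱ σp<b (subst (b ≤_) (sym (σ-top p≡a)) b≤N))

      left-order : ∀ {x y} → x < a → y < a → σ x < σ y → α x < α y
      left-order x<a y<a = Monotone.reflects α σ
        (λ x<a y<a αx<αy → subst₂ _<_ (sym (glue-left x<a)) (sym (glue-left y<a))
                             (lift-mono (bounded ρ-av 0 0<b) αx<αy))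
        x<a y<a (λ αx≡αy → trans (glue-left x<a) (trans (cong (lift (ρ 0) b) αx≡αy) (sym (glue-left y<a))))

      into-α : Embedding (_< a) a σ α
      into-α = record { φ = id ; φ-mono = λ _ _ x<y → x<y ; φ<n = id ; φ-order = left-order }

      into-ρ : Embedding Low b σ ρ
      into-ρ = record
        { φ = _∸ a ; φ-mono = low-mono ; φ<n = p∸a<b ∘ low<1+N
        ; φ-order = λ lx ly → subst₂ _<_ (σ-low lx) (σ-low ly) }

      σ<1+N : Bounded (suc N) σ
      σ<1+N p p<1+N with view p<1+N
      ... | low lp        = <-≤-trans (σ-low<b lp) (m≤n⇒m≤1+n b≤N)
      ... | high _ p<a αp = m<n⇒m<1+n (σ-high<N p<a αp)
      ... | top p≡a       = subst (_< suc N) (sym (σ-top p≡a)) ≤-refl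

      σ-inj : InjectiveBelow (suc N) σ
      σ-inj x<1+N y<1+N σx≡σy with view x<1+N | view y<1+N
      ... | low lx | low ly = Monotone.injective id (_∸ a) low-mono lx ly
              (injective ρ-av (p∸a<b x<1+N) (p∸a<b y<1+N) (trans (sym (σ-low lx)) (trans σx≡σy (σ-low ly))))
      ... | high _ x<a αx | high _ y<a αy = injective α-av x<a y<a (trans αx (trans (cong suc
              (+-cancelʳ-≡ b _ _ (trans (sym (σ-high x<a αx)) (trans σx≡σy (σ-high y<a αy))))) (sym αy)))
      ... | top x≡a | top y≡a = trans x≡a (sym y≡a)
      ... | low lx | high _ y<a αy = ⊥-elim (<⇒≢ (<-≤-trans (σ-low<b lx) (b≤σ-high y<a αy)) σx≡σy)
      ... | high _ x<a αx | low ly = ⊥-elim (<⇒≢ (<-≤-trans (σ-low<b ly) (b≤σ-high x<a αx)) (sym σx≡σy))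
      ... | low lx | top y≡a = ⊥-elim (<⇒≢ (<-≤-trans (σ-low<b lx) b≤N) (trans σx≡σy (σ-top y≡a)))
      ... | top x≡a | low ly = ⊥-elim (<⇒≢ (<-≤-trans (σ-low<b ly) b≤N) (trans (sym σx≡σy) (σ-top x≡a)))
      ... | high _ x<a αx | top y≡a = ⊥-elim (<⇒≢ (σ-high<N x<a αx) (trans σx≡σy (σ-top y≡a)))
      ... | top x≡a | high _ y<a αy = ⊥-elim (<⇒≢ (σ-high<N y<a αy) (trans (sym σx≡σy) (σ-top x≡a)))

      -- Look at the entry playing the role of 3: if it is N nothing can exceed it, if it lies in
      -- the copy of α the whole occurrence does, and if it is an entry of ρ so are the others.
      no-occ : ¬ Occ1243∨2143 (suc N) σ
      no-occ o with view (Occ1243∨2143.l<n o)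
      ... | top l≡a = <-irrefl refl (<-≤-trans (subst (_< σ k) (σ-top l≡a) fl<fk) (≤-pred (σ<1+N k k<n)))
        where open Occ1243∨2143 o
      ... | high _ l<a _ = no-1243∨2143 α-av (occ-embed into-α o (<-trans i<j j<a) j<a (<-trans k<l l<a) l<a)
        where
        open Occ1243∨2143 o
        j<a : Occ1243∨2143.j o < a
        j<a = <-trans j<k (<-trans k<l l<a)
      ... | low ll = no-1243∨2143 ρ-av (occ-embed into-ρ o li lj (inj₂ (<-trans a<j j<k , k<n)) ll)
        where
        open Occ1243∨2143 o
        li : Low i
        li = low-of-small i<n (<-trans fi<fl (σ-low<b ll))
        lj : Low (Occ1243∨2143.j o)
        lj = low-of-small j<n (<-trans fj<fl (σ-low<b ll))
        a<j : a < Occ1243∨2143.j o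
        a<j = later-low-is-right li lj i<j

      left-of-last : (s : IncreasingSubseq (suc (suc j)) (suc N) σ) → IncreasingSubseq.pos s (suc j) ≤ a →
                     ∀ {t} → t < suc j → IncreasingSubseq.pos s t < a
      left-of-last s z≤a t<r = <-≤-trans (proj₁ (IncreasingSubseq.increasing s t<r ≤-refl)) z≤a

      -- Split at the last entry z of the increasing subsequence: if z ≤ a the rest lies left of a,
      -- giving one of length suc j in α; otherwise everything is an entry of ρ.
      no-inc : ¬ IncreasingSubseq (suc (suc j)) (suc N) σ
      no-inc s with view (IncreasingSubseq.pos<n s ≤-refl)
      ... | high _ z<a _ = no-increasing α-av (inc-embed into-α (inc-init s) (left-of-last s (<⇒≤ z<a)))
      ... | top z≡a      = no-increasing α-av (inc-embed into-α (inc-init s) (left-of-last s (≤-reflexive z≡a)))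
      ... | low lz       = no-increasing ρ-av (inc-embed into-ρ s low-pos)
        where
        open IncreasingSubseq s
        low-pos : ∀ {t} → t < suc (suc j) → Low (pos t)
        low-pos {t} t<r with m≤n⇒m<n∨m≡n (≤-pred t<r)
        ... | inj₁ t<last = low-of-small (pos<n t<r) (<-trans (proj₂ (increasing t<last ≤-refl)) (σ-low<b lz))
        ... | inj₂ refl   = lz

    glue-avoider : Avoider (suc j) (suc N) σ
    glue-avoider = record { bounded = σ<1+N ; injective = σ-inj ; no-1243∨2143 = no-occ ; no-increasing = no-inc }

  module Decomposition {j N a : ℕ} {f : ℕ → ℕ} (f-av : Avoider (suc j) (suc N) f)
                       (0<a : 0 < a) (a<1+N : a < suc N) (fa≡N : f a ≡ N) where

    b : ℕ
    b = suc N ∸ a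

    a+b≡1+N : a + b ≡ suc N
    a+b≡1+N = m+[n∸m]≡n (<⇒≤ a<1+N)

    0<b : 0 < b
    0<b = m<n⇒0<n∸m a<1+N

    private
      <a⇒<1+N : ∀ {p} → p < a → p < suc N
      <a⇒<1+N p<a = <-trans p<a a<1+N

      f<N : ∀ {p} → p < suc N → p ≢ a → f p < N
      f<N p<1+N p≢a = ≤∧≢⇒< (≤-pred (bounded f-av _ p<1+N))
                            (λ fp≡N → p≢a (injective f-av p<1+N a<1+N (trans fp≡N (sym fa≡N))))

      p₀ : ℕ
      p₀ = argmin f 0 (upTo a)

      p₀<a : p₀ < a
      p₀<a = argmin-all f 0<a (Allₚ.all-upTo a)

      p₀-min : ∀ {p} → p < a → f p₀ ≤ f p
      p₀-min = Allₚ.applyUpTo⁻ id a (f[argmin]≤f[xs] 0 (upTo a))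

      p₀-below-left : ∀ {p} → p < a → p ≢ p₀ → f p₀ < f p
      p₀-below-left p<a p≢p₀ = ≤∧≢⇒< (p₀-min p<a)
        (λ fp₀≡fp → p≢p₀ (sym (injective f-av (<a⇒<1+N p₀<a) (<a⇒<1+N p<a) fp₀≡fp)))

      right-below-left : ∀ {p q} → p < a → p ≢ p₀ → a < q → q < suc N → f q < f p
      right-below-left {p} {q} p<a p≢p₀ a<q q<1+N =
        ≰⇒> (λ fp≤fq → no-1243∨2143 f-av (occurrence (≤∧≢⇒< fp≤fq fp≢fq)))
        where
        fp≢fq : f p ≢ f q
        fp≢fq fp≡fq = <-asym p<a (subst (a <_) (injective f-av q<1+N (<a⇒<1+N p<a) (sym fp≡fq)) a<q)
        fq<fa : f q < f a
        fq<fa = subst (f q <_) (sym fa≡N) (f<N q<1+N (λ q≡a → <-irrefl (sym q≡a) a<q))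
        -- p and p₀ (in either order), a and q would carry a 1243 or a 2143, with f a = N as the 4.
        occurrence : f p < f q → Occ1243∨2143 (suc N) f
        occurrence fp<fq with <-cmp p p₀
        ... | tri< p<p₀ _ _ = occ p<p₀ p₀<a a<q q<1+N fp<fq (<-trans (p₀-below-left p<a p≢p₀) fp<fq) fq<fa
        ... | tri≈ _ p≡p₀ _ = ⊥-elim (p≢p₀ p≡p₀)
        ... | tri> _ _ p₀<p = occ p₀<p p<a a<q q<1+N (<-trans (p₀-below-left p<a p≢p₀) fp<fq) fp<fq fq<fa

      -- The b positions whose entries will form ρ, and the a positions carrying the entries ≥ b.
      Small : ℕ → Set
      Small s = s ≡ p₀ ⊎ (a < s × s < suc N)

      Large : ℕ → Set
      Large t = t ≤ a × t ≢ p₀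

      small<1+N : ∀ {s} → Small s → s < suc N
      small<1+N (inj₁ refl)       = <a⇒<1+N p₀<a
      small<1+N (inj₂ (_ , s<1+N)) = s<1+N

      large<1+N : ∀ {t} → Large t → t < suc N
      large<1+N (t≤a , _) = ≤-<-trans t≤a a<1+N

      small<large : ∀ {s t} → Small s → Large t → f s < f t
      small<large {s} {t} small-s (t≤a , t≢p₀) with m≤n⇒m<n∨m≡n t≤a | small-s
      ... | inj₁ t<a | inj₁ refl             = p₀-below-left t<a t≢p₀
      ... | inj₁ t<a | inj₂ (a<s , s<1+N)    = right-below-left t<a t≢p₀ a<s s<1+N
      ... | inj₂ refl | _ = subst (f s <_) (sym fa≡N) (f<N (small<1+N small-s) (small≢a small-s))
        where
        small≢a : ∀ {s} → Small s → s ≢ t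
        small≢a (inj₁ refl)     s≡a = <-irrefl s≡a p₀<a
        small≢a (inj₂ (a<s , _)) s≡a = <-irrefl (sym s≡a) a<s

      small-pos : ℕ → ℕ
      small-pos zero    = p₀
      small-pos (suc q) = suc q + a

      small-pos-small : ∀ {q} → q < b → Small (small-pos q)
      small-pos-small {zero}  _   = inj₁ refl
      small-pos-small {suc q} q<b =
        inj₂ (s≤s (m≤n+m a q) , subst (suc q + a <_) (trans (+-comm b a) a+b≡1+N) (+-monoˡ-< a q<b))

      small-pos-mono : ∀ {x y} → x < y → small-pos x < small-pos y
      small-pos-mono {zero}  {suc y} _   = <-≤-trans p₀<a (m≤n+m a (suc y))
      small-pos-mono {suc x} {suc y} x<y = +-monoˡ-< a x<y

      small-pos-right : ∀ {p} → a < p → small-pos (p ∸ a) ≡ p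
      small-pos-right {p} a<p with p ∸ a in p∸a
      ... | zero  = ⊥-elim (<-irrefl (sym p∸a) (m<n⇒0<n∸m a<p))
      ... | suc q = trans (cong (_+ a) (sym p∸a)) (m∸n+n≡m (<⇒≤ a<p))

      f∘small-pos-injective : InjectiveBelow b (f ∘ small-pos)
      f∘small-pos-injective x<b y<b = Monotone.injective id small-pos (λ _ _ → small-pos-mono) x<b y<b
        ∘ injective f-av (small<1+N (small-pos-small x<b)) (small<1+N (small-pos-small y<b))

      large-pos : ℕ → ℕ
      large-pos t with t <? p₀
      ... | yes _ = t
      ... | no  _ = suc t

      large-pos-large : ∀ {t} → t < a → Large (large-pos t)
      large-pos-large {t} t<a with t <? p₀
      ... | yes t<p₀ = <⇒≤ t<a , λ t≡p₀ → <-irrefl t≡p₀ t<p₀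
      ... | no  t≮p₀ = t<a , λ 1+t≡p₀ → t≮p₀ (subst (t <_) 1+t≡p₀ ≤-refl)

      large-pos-mono : ∀ {x y} → x < y → large-pos x < large-pos y
      large-pos-mono {x} {y} x<y with x <? p₀ | y <? p₀
      ... | yes _   | yes _   = x<y
      ... | yes _   | no  _   = m<n⇒m<1+n x<y
      ... | no  x≮p₀ | yes y<p₀ = ⊥-elim (x≮p₀ (<-trans x<y y<p₀))
      ... | no  _   | no  _   = s≤s x<y

      -- Counting: b distinct entries lie below each large entry, and a distinct entries above each
      -- small one, so the small entries are exactly 0, …, b - 1.
      b≤large : ∀ {t} → Large t → b ≤ f t
      b≤large large-t = pigeonhole (f ∘ small-pos) (λ q q<b → small<large (small-pos-small q<b) large-t)
                                   f∘small-pos-injective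

      small<b : ∀ {s} → Small s → f s < b
      small<b {s} small-s =
        +-cancelʳ-< a (f s) b (subst (f s + a <_) (trans (sym a+b≡1+N) (+-comm a b)) (s≤s fs+a≤N))
        where
        fs<large : ∀ {t} → t < a → f s < f (large-pos t)
        fs<large t<a = small<large small-s (large-pos-large t<a)
        above : ∀ t → t < a → f (large-pos t) ∸ suc (f s) < N ∸ f s
        above t t<a = ∸-monoˡ-< (bounded f-av _ (large<1+N (large-pos-large t<a))) (fs<large t<a)
        a≤N∸fs : a ≤ N ∸ f s
        a≤N∸fs = pigeonhole (λ t → f (large-pos t) ∸ suc (f s)) above λ x<a y<a e →
          Monotone.injective id large-pos (λ _ _ → large-pos-mono) x<a y<a
            (injective f-av (large<1+N (large-pos-large x<a)) (large<1+N (large-pos-large y<a))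
              (∸-cancelʳ-≡ (fs<large x<a) (fs<large y<a) e))
        fs+a≤N : f s + a ≤ N
        fs+a≤N = subst (f s + a ≤_) (m+[n∸m]≡n (≤-pred (bounded f-av s (small<1+N small-s))))
                       (+-monoʳ-≤ (f s) a≤N∸fs)

    α : ℕ → ℕ
    α = lower b ∘ f

    ρ : ℕ → ℕ
    ρ = f ∘ small-pos

    private
      α-mono : ∀ {x y} → x < a → y < a → f x < f y → α x < α y
      α-mono {x} {y} x<a y<a fx<fy with y ≟ p₀
      ... | yes refl  = ⊥-elim (<⇒≱ fx<fy (p₀-min x<a))
      ... | no  y≢p₀  = lower-mono fx<fy (b≤large (<⇒≤ y<a , y≢p₀))

      α<a : Bounded a α
      α<a p p<a with b ≤? f p
      ... | no  b≰fp = subst (_< a) (sym (lower-< (≰⇒> b≰fp))) 0<a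
      ... | yes b≤fp = subst (_< a) (sym (lower-≥ b≤fp))
        (+-cancelʳ-< b (suc (f p ∸ b)) a (subst₂ _<_ (cong suc (sym (m∸n+n≡m b≤fp))) (sym a+b≡1+N)
          (s≤s (f<N (<a⇒<1+N p<a) (λ p≡a → <-irrefl p≡a p<a)))))

      from-α : Embedding (_< a) (suc N) α f
      from-α = record
        { φ = id ; φ-mono = λ _ _ x<y → x<y ; φ<n = <a⇒<1+N
        ; φ-order = λ x<a y<a → Monotone.reflects f α α-mono x<a y<a (cong (lower b)) }

      from-ρ : Embedding (_< b) (suc N) ρ f
      from-ρ = record
        { φ = small-pos ; φ-mono = λ _ _ → small-pos-mono ; φ<n = small<1+N ∘ small-pos-small
        ; φ-order = λ _ _ ρx<ρy → ρx<ρy }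

    α-avoider : Avoider j a α
    α-avoider = record
      { bounded = α<a
      ; injective = λ x<a y<a αx≡αy → injective f-av (<a⇒<1+N x<a) (<a⇒<1+N y<a)
                      (Monotone.injective f α α-mono x<a y<a αx≡αy)
      ; no-1243∨2143 = no-1243∨2143 f-av ∘ occ-embed< from-α
      ; no-increasing = λ s → no-increasing f-av (inc-snoc (inc-embed< from-α s) a<1+N (below-max s))
      }
      where
      below-max : ∀ (s : IncreasingSubseq (suc j) a α) {t} → t < suc j →
                  IncreasingSubseq.pos s t < a × f (IncreasingSubseq.pos s t) < f a
      below-max s t<r = pos<a , subst (f _ <_) (sym fa≡N) (f<N (<a⇒<1+N pos<a) (λ p≡a → <-irrefl p≡a pos<a))
        where pos<a = IncreasingSubseq.pos<n s t<r

    ρ-avoider : Avoider (suc j) b ρ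
    ρ-avoider = avoider-embed from-ρ (λ q q<b → small<b (small-pos-small q<b)) f∘small-pos-injective f-av

    f≗glue : ∀ p → p < suc N → f p ≡ glue a b N α ρ p
    f≗glue p p<1+N with <-cmp p a
    ... | tri≈ _ refl _ = fa≡N
    ... | tri> _ _ a<p  = cong f (sym (small-pos-right a<p))
    ... | tri< p<a _ _ with p ≟ p₀
    ...   | yes refl = sym (cong (lift (f p₀) b) (lower-< (small<b (inj₁ refl))))
    ...   | no  p≢p₀ = sym (lift-lower (b≤large (<⇒≤ p<a , p≢p₀)))

  glue-injective : ∀ {a b N α α′ ρ ρ′} → Bounded a α → InjectiveBelow a α → 0 < a → ρ 0 < b → ρ′ 0 < b →
                   a + b ≡ suc N → (∀ p → p < suc N → glue a b N α ρ p ≡ glue a b N α′ ρ′ p) →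
                   (∀ p → p < a → α p ≡ α′ p) × (∀ q → q < b → ρ q ≡ ρ′ q)
  glue-injective {a} {b} {N} {α} {α′} {ρ} {ρ′} α<a α-inj 0<a ρ₀<b ρ′₀<b a+b≡1+N same = α≗α′ , ρ≗ρ′
    where
    module G = Glue a b N α ρ
    module G′ = Glue a b N α′ ρ′
    open ≡-Reasoning

    <a⇒<1+N : ∀ {p} → p < a → p < suc N
    <a⇒<1+N p<a = <-≤-trans p<a (subst (a ≤_) a+b≡1+N (m≤m+n a b))

    α≗α′ : ∀ p → p < a → α p ≡ α′ p
    α≗α′ p p<a = begin
      α p                            ≡⟨ lower-lift (α p) ρ₀<b ⟨
      lower b (lift (ρ 0) b (α p))   ≡⟨ cong (lower b) (G.glue-left p<a) ⟨
      lower b (G.σ p)                ≡⟨ cong (lower b) (same p (<a⇒<1+N p<a)) ⟩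
      lower b (G′.σ p)               ≡⟨ cong (lower b) (G′.glue-left p<a) ⟩
      lower b (lift (ρ′ 0) b (α′ p)) ≡⟨ lower-lift (α′ p) ρ′₀<b ⟩
      α′ p                           ∎

    -- ρ 0 is stored at the zero of α.
    ρ≗ρ′ : ∀ q → q < b → ρ q ≡ ρ′ q
    ρ≗ρ′ zero _ with bounded-injective⇒surjective α<a α-inj 0<a
    ... | z , z<a , αz≡0 = begin
      ρ 0                       ≡⟨ cong (lift (ρ 0) b) αz≡0 ⟨
      lift (ρ 0) b (α z)        ≡⟨ G.glue-left z<a ⟨
      G.σ z                     ≡⟨ same z (<a⇒<1+N z<a) ⟩
      G′.σ z                    ≡⟨ G′.glue-left z<a ⟩
      lift (ρ′ 0) b (α′ z)      ≡⟨ cong (lift (ρ′ 0) b) (trans (sym (α≗α′ z z<a)) αz≡0) ⟩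
      ρ′ 0                      ∎
    ρ≗ρ′ (suc q) q<b = begin
      ρ (suc q)                 ≡⟨ cong ρ (m+n∸n≡m (suc q) a) ⟨
      ρ (suc q + a ∸ a)         ≡⟨ G.glue-right a<p ⟨
      G.σ (suc q + a)           ≡⟨ same (suc q + a) p<1+N ⟩
      G′.σ (suc q + a)          ≡⟨ G′.glue-right a<p ⟩
      ρ′ (suc q + a ∸ a)        ≡⟨ cong ρ′ (m+n∸n≡m (suc q) a) ⟩
      ρ′ (suc q)                ∎
      where
      a<p : a < suc q + a
      a<p = s≤s (m≤n+m a q)
      p<1+N : suc q + a < suc N
      p<1+N = subst (suc q + a <_) (trans (+-comm b a) a+b≡1+N) (+-monoˡ-< a q<b)

  glue-cong : ∀ {a b N α α′ ρ ρ′} → 0 < b → (∀ p → p < a → α p ≡ α′ p) → (∀ q → q < b → ρ q ≡ ρ′ q) →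
              ∀ p → p < a + b → glue a b N α ρ p ≡ glue a b N α′ ρ′ p
  glue-cong {a} {b} 0<b α≗α′ ρ≗ρ′ p p<a+b with <-cmp p a
  ... | tri< p<a _ _ = cong₂ (λ r u → lift r b u) (ρ≗ρ′ 0 0<b) (α≗α′ p p<a)
  ... | tri≈ _ _ _   = refl
  ... | tri> _ _ a<p = ρ≗ρ′ (p ∸ a) (subst (p ∸ a <_) (m+n∸m≡n a b) (∸-monoˡ-< p<a+b (<⇒≤ a<p)))

  entry : ∀ {n m} → Vec (Fin n) m → ℕ → ℕ
  entry Vec.[]       _       = 0
  entry (x Vec.∷ _)  zero    = toℕ x
  entry (_ Vec.∷ σ) (suc i) = entry σ i

  entry-lookup : ∀ {n m} (σ : Vec (Fin n) m) (i : Fin m) → entry σ (toℕ i) ≡ toℕ (lookup σ i)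
  entry-lookup (x Vec.∷ σ) Fin.zero    = refl
  entry-lookup (x Vec.∷ σ) (Fin.suc i) = entry-lookup σ i

  entry-fromℕ< : ∀ {n m} (σ : Vec (Fin n) m) {i} (i<m : i < m) → entry σ i ≡ toℕ (lookup σ (fromℕ< i<m))
  entry-fromℕ< σ i<m = trans (cong (entry σ) (sym (Finₚ.toℕ-fromℕ< i<m))) (entry-lookup σ (fromℕ< i<m))

  entry<n : ∀ {n} (σ : Vec (Fin n) n) → Bounded n (entry σ)
  entry<n σ i i<n = subst (_< _) (sym (entry-fromℕ< σ i<n)) (Finₚ.toℕ<n _)

  entry-ext : ∀ {n m} (σ τ : Vec (Fin n) m) → (∀ i → i < m → entry σ i ≡ entry τ i) → σ ≡ τ
  entry-ext σ τ σ≗τ = trans (sym (tabulate∘lookup σ)) (trans (tabulate-cong same) (tabulate∘lookup τ))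
    where
    same : ∀ i → lookup σ i ≡ lookup τ i
    same i = Finₚ.toℕ-injective
      (trans (sym (entry-lookup σ i)) (trans (σ≗τ (toℕ i) (Finₚ.toℕ<n i)) (entry-lookup τ i)))

  clamp : ∀ {n} → Fin n → ℕ → Fin n
  clamp {n} d v with v <? n
  ... | yes v<n = fromℕ< v<n
  ... | no  _   = d

  toℕ-clamp : ∀ {n v} (d : Fin n) → v < n → toℕ (clamp d v) ≡ v
  toℕ-clamp {n} {v} d v<n with v <? n
  ... | yes _   = Finₚ.toℕ-fromℕ< v<n
  ... | no  v≮n = ⊥-elim (v≮n v<n)

  fromFun : (n : ℕ) → (ℕ → ℕ) → Vec (Fin n) n
  fromFun n f = tabulate λ i → clamp i (f (toℕ i))

  entry-fromFun : ∀ {n} (f : ℕ → ℕ) {i} → i < n → f i < n → entry (fromFun n f) i ≡ f i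
  entry-fromFun {n} f {i} i<n fi<n = begin
    entry (fromFun n f) i                           ≡⟨ entry-fromℕ< (fromFun n f) i<n ⟩
    toℕ (lookup (fromFun n f) (fromℕ< i<n))         ≡⟨ cong toℕ (lookup∘tabulate _ (fromℕ< i<n)) ⟩
    toℕ (clamp (fromℕ< i<n) (f (toℕ (fromℕ< i<n))))
                                                    ≡⟨ cong (toℕ ∘ clamp (fromℕ< i<n) ∘ f) (Finₚ.toℕ-fromℕ< i<n) ⟩
    toℕ (clamp (fromℕ< i<n) (f i))                  ≡⟨ toℕ-clamp (fromℕ< i<n) fi<n ⟩
    f i                                             ∎
    where open ≡-Reasoning

  isPerm⇔injective : ∀ {n} (σ : Vec (Fin n) n) → IsPerm σ ⇔ InjectiveBelow n (entry σ)
  isPerm⇔injective σ = mk⇔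
    (λ perm {x} {y} x<n y<n σx≡σy → Finₚ.fromℕ<-injective x y x<n y<n (perm _ _ (Finₚ.toℕ-injective
       (trans (sym (entry-fromℕ< σ x<n)) (trans σx≡σy (entry-fromℕ< σ y<n))))))
    (λ inj x y σx≡σy → Finₚ.toℕ-injective (inj (Finₚ.toℕ<n x) (Finₚ.toℕ<n y)
       (trans (entry-lookup σ x) (trans (cong toℕ σx≡σy) (sym (entry-lookup σ y))))))

  increasing-by-steps : ∀ {lo hi} (h : ℕ → ℕ) → (∀ r → lo ≤ r → suc r ≤ hi → h r < h (suc r)) →
                        ∀ {r s} → lo ≤ r → r < s → s ≤ hi → h r < h s
  increasing-by-steps h step {r} {suc s} lo≤r (s≤s r≤s) 1+s≤hi with m≤n⇒m<n∨m≡n r≤s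
  ... | inj₂ refl = step r lo≤r 1+s≤hi
  ... | inj₁ r<s  = <-trans (increasing-by-steps h step lo≤r r<s (≤-trans (n≤1+n s) 1+s≤hi))
                            (step s (≤-trans lo≤r (<⇒≤ r<s)) 1+s≤hi)

  contains-by-ranking : ∀ {n} (p : List ℕ) (σ : Vec (Fin n) n) (q h : ℕ → ℕ) →
    (∀ {s t} → s < t → t < length p → q s < q t) → (∀ {t} → t < length p → q t < n) →
    (∀ x → entry σ (q (toℕ x)) ≡ h (List.lookup p x)) →
    (∀ x y → List.lookup p x < List.lookup p y → h (List.lookup p x) < h (List.lookup p y)) →
    Contains p σ
  contains-by-ranking {n} p σ q h q-mono q<n values h-mono = pos , pos-mono , λ x y → mk⇔ to (from x y)
    where
    pos : Fin (length p) → Fin n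
    pos x = fromℕ< (q<n (Finₚ.toℕ<n x))

    value : ∀ x → toℕ (lookup σ (pos x)) ≡ h (List.lookup p x)
    value x = trans (sym (entry-lookup σ (pos x))) (trans (cong (entry σ) (Finₚ.toℕ-fromℕ< _)) (values x))

    pos-mono : ∀ x y → x <ᶠ y → pos x <ᶠ pos y
    pos-mono x y x<y =
      subst₂ _<_ (sym (Finₚ.toℕ-fromℕ< _)) (sym (Finₚ.toℕ-fromℕ< _)) (q-mono x<y (Finₚ.toℕ<n y))

    to : ∀ {x y} → List.lookup p x < List.lookup p y → lookup σ (pos x) <ᶠ lookup σ (pos y)
    to {x} {y} px<py = subst₂ _<_ (sym (value x)) (sym (value y)) (h-mono x y px<py)

    from : ∀ x y → lookup σ (pos x) <ᶠ lookup σ (pos y) → List.lookup p x < List.lookup p y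
    from x y = Monotone.reflects {D = λ _ → ⊤} (List.lookup p) (toℕ ∘ lookup σ ∘ pos) (λ _ _ → to) tt tt
                 (λ px≡py → trans (value x) (trans (cong h px≡py) (sym (value y))))

  increasing-on-pattern : ∀ {lo hi} (p : List ℕ) (h : ℕ → ℕ) → All (λ r → lo ≤ r × r ≤ hi) p →
    (∀ r → lo ≤ r → suc r ≤ hi → h r < h (suc r)) →
    ∀ x y → List.lookup p x < List.lookup p y → h (List.lookup p x) < h (List.lookup p y)
  increasing-on-pattern {lo} {hi} p h in-range step x y px<py =
    increasing-by-steps h step (proj₁ (range x)) px<py (proj₂ (range y))
    where
    range : ∀ z → lo ≤ List.lookup p z × List.lookup p z ≤ hi
    range z = All.lookup in-range (∈-lookup {xs = p} z)

  p1243 p2143 : List ℕ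
  p1243 = 1 ∷ 2 ∷ 4 ∷ 3 ∷ []
  p2143 = 2 ∷ 1 ∷ 4 ∷ 3 ∷ []

  module _ {n} (σ : Vec (Fin n) n) (o : Occ1243∨2143 n (entry σ)) where
    open Occ1243∨2143 o

    private
      q : ℕ → ℕ
      q 0 = i
      q 1 = j
      q 2 = k
      q _ = l

      q-mono : ∀ {s t} → s < t → t < 4 → q s < q t
      q-mono s<t t<4 = increasing-by-steps q step z≤n s<t (≤-pred t<4)
        where
        step : ∀ r → 0 ≤ r → suc r ≤ 3 → q r < q (suc r)
        step 0 _ _ = i<j
        step 1 _ _ = j<k
        step 2 _ _ = k<l
        step (suc (suc (suc _))) _ (s≤s (s≤s (s≤s ())))

      q<n : ∀ {t} → t < 4 → q t < n
      q<n {0} _ = i<n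
      q<n {1} _ = j<n
      q<n {2} _ = k<n
      q<n {3} _ = l<n
      q<n {suc (suc (suc (suc _)))} (s≤s (s≤s (s≤s (s≤s ()))))

      -- u and w are the entries playing 1 and 2.
      rank : ℕ → ℕ → ℕ → ℕ
      rank u w 1 = u
      rank u w 2 = w
      rank u w 3 = entry σ l
      rank u w _ = entry σ k

      rank-step : ∀ {u w} → u < w → w < entry σ l →
                  ∀ r → 1 ≤ r → suc r ≤ 4 → rank u w r < rank u w (suc r)
      rank-step u<w _   1 _ _ = u<w
      rank-step _   w<l 2 _ _ = w<l
      rank-step _   _   3 _ _ = fl<fk
      rank-step _   _   (suc (suc (suc (suc _)))) _ (s≤s (s≤s (s≤s (s≤s ()))))

      in-range : ∀ p → {_ : True (all? (λ r → (1 ≤? r) ×-dec (r ≤? 4)) p)} →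
                 All (λ r → 1 ≤ r × r ≤ 4) p
      in-range p {t} = toWitness t

    occ⇒contains : InjectiveBelow n (entry σ) → Contains p1243 σ ⊎ Contains p2143 σ
    occ⇒contains σ-inj with <-cmp (entry σ i) (entry σ j)
    ... | tri< σi<σj _ _ = inj₁ (contains-by-ranking p1243 σ q (rank (entry σ i) (entry σ j)) q-mono q<n
            (λ { Fin.zero → refl ; (Fin.suc Fin.zero) → refl ; (Fin.suc (Fin.suc Fin.zero)) → refl
               ; (Fin.suc (Fin.suc (Fin.suc Fin.zero))) → refl })
            (increasing-on-pattern p1243 _ (in-range p1243) (rank-step σi<σj fj<fl)))
    ... | tri≈ _ σi≡σj _ = ⊥-elim (<-irrefl (σ-inj i<n j<n σi≡σj) i<j)
    ... | tri> _ _ σj<σi = inj₂ (contains-by-ranking p2143 σ q (rank (entry σ j) (entry σ i)) q-mono q<n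
            (λ { Fin.zero → refl ; (Fin.suc Fin.zero) → refl ; (Fin.suc (Fin.suc Fin.zero)) → refl
               ; (Fin.suc (Fin.suc (Fin.suc Fin.zero))) → refl })
            (increasing-on-pattern p2143 _ (in-range p2143) (rank-step σj<σi fi<fl)))

  contains-ab43⇒occ : ∀ {n a b c d} (σ : Vec (Fin n) n) → a < d → b < d → d < c →
                      Contains (a ∷ b ∷ c ∷ d ∷ []) σ → Occ1243∨2143 n (entry σ)
  contains-ab43⇒occ {a = a} {b} {c} {d} σ a<d b<d d<c (g , g-mono , g-iso) =
    occ (g-mono (# 0) (# 1) z<s) (g-mono (# 1) (# 2) (s<s z<s)) (g-mono (# 2) (# 3) (s<s (s<s z<s)))
        (Finₚ.toℕ<n _) (value-order (# 0) (# 3) a<d) (value-order (# 1) (# 3) b<d) (value-order (# 3) (# 2) d<c)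
    where
    value-order : ∀ x y → List.lookup (a ∷ b ∷ c ∷ d ∷ []) x < List.lookup (a ∷ b ∷ c ∷ d ∷ []) y →
                  entry σ (toℕ (g x)) < entry σ (toℕ (g y))
    value-order x y lt =
      subst₂ _<_ (sym (entry-lookup σ (g x))) (sym (entry-lookup σ (g y))) (Equivalence.to (g-iso x y) lt)

  lookup-map-suc-applyUpTo : ∀ (g : ℕ → ℕ) r x → List.lookup (map suc (applyUpTo g r)) x ≡ suc (g (toℕ x))
  lookup-map-suc-applyUpTo g (suc r) Fin.zero    = refl
  lookup-map-suc-applyUpTo g (suc r) (Fin.suc x) = lookup-map-suc-applyUpTo (g ∘ suc) r x

  lookup-idPat : ∀ r x → List.lookup (idPat r) x ≡ suc (toℕ x)
  lookup-idPat = lookup-map-suc-applyUpTo id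

  length-idPat : ∀ r → length (idPat r) ≡ r
  length-idPat r = trans (length-map suc (upTo r)) (length-upTo r)

  inc⇒contains-idPat : ∀ {r n} (σ : Vec (Fin n) n) → IncreasingSubseq r n (entry σ) → Contains (idPat r) σ
  inc⇒contains-idPat {r} σ (incr pos pos<n increasing) =
    contains-by-ranking (idPat r) σ pos h (λ s<t t<L → proj₁ (increasing s<t (<r t<L))) (pos<n ∘ <r)
                        values h-mono
    where
    <r : ∀ {t} → t < length (idPat r) → t < r
    <r = subst (_ <_) (length-idPat r)
    h : ℕ → ℕ
    h t = entry σ (pos (pred t))
    values : ∀ x → entry σ (pos (toℕ x)) ≡ h (List.lookup (idPat r) x)
    values x = cong h (sym (lookup-idPat r x))
    h-mono : ∀ x y → List.lookup (idPat r) x < List.lookup (idPat r) y →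
             h (List.lookup (idPat r) x) < h (List.lookup (idPat r) y)
    h-mono x y = subst₂ (λ u w → u < w → h u < h w) (sym (lookup-idPat r x)) (sym (lookup-idPat r y))
                   (λ 1+x<1+y → proj₂ (increasing (≤-pred 1+x<1+y) (<r (Finₚ.toℕ<n y))))

  contains-idPat⇒inc : ∀ {r n} (σ : Vec (Fin n) n) → Contains (idPat r) σ → IncreasingSubseq r n (entry σ)
  contains-idPat⇒inc {r} {n} σ (g , g-mono , g-iso) =
    subst (λ L → IncreasingSubseq L n (entry σ)) (length-idPat r)
    (incr pos (λ {t} t<L → subst (_< n) (sym (pos-fromℕ< t<L)) (Finₚ.toℕ<n _)) increasing)
    where
    L : ℕ
    L = length (idPat r)

    pos : ℕ → ℕ
    pos t with t <? L
    ... | yes t<L = toℕ (g (fromℕ< t<L))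
    ... | no  _   = 0

    pos-fromℕ< : ∀ {t} (t<L : t < L) → pos t ≡ toℕ (g (fromℕ< t<L))
    pos-fromℕ< {t} t<L with t <? L
    ... | yes _   = refl
    ... | no  t≮L = ⊥-elim (t≮L t<L)

    increasing : ∀ {s t} → s < t → t < L → pos s < pos t × entry σ (pos s) < entry σ (pos t)
    increasing {s} {t} s<t t<L = subst₂ _<_ (sym (pos-fromℕ< s<L)) (sym (pos-fromℕ< t<L)) (g-mono S T S<T)
                               , subst₂ _<_ (sym (value s<L)) (sym (value t<L)) (Equivalence.to (g-iso S T) pS<pT)
      where
      s<L : s < L
      s<L = <-trans s<t t<L
      S T : Fin L
      S = fromℕ< s<L
      T = fromℕ< t<L
      S<T : S <ᶠ T
      S<T = subst₂ _<_ (sym (Finₚ.toℕ-fromℕ< s<L)) (sym (Finₚ.toℕ-fromℕ< t<L)) s<t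
      pS<pT : List.lookup (idPat r) S < List.lookup (idPat r) T
      pS<pT = subst₂ _<_ (sym (lookup-idPat r S)) (sym (lookup-idPat r T)) (s≤s S<T)
      value : ∀ {u} (u<L : u < L) → entry σ (pos u) ≡ toℕ (lookup σ (g (fromℕ< u<L)))
      value u<L = trans (cong (entry σ) (pos-fromℕ< u<L)) (entry-lookup σ _)

  InS⇔avoider : ∀ {j n} (σ : Vec (Fin n) n) → InS n (R5 (suc j)) σ ⇔ Avoider j n (entry σ)
  InS⇔avoider {j} {n} σ = mk⇔ to from
    where
    to : InS n (R5 (suc j)) σ → Avoider j n (entry σ)
    to (perm , avoids₁₂₄₃ All.∷ avoids₂₁₄₃ All.∷ avoids-id All.∷ All.[]) = record
      { bounded = entry<n σ
      ; injective = σ-inj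
      ; no-1243∨2143 = λ o → [ avoids₁₂₄₃ , avoids₂₁₄₃ ]′ (occ⇒contains σ o σ-inj)
      ; no-increasing = avoids-id ∘ inc⇒contains-idPat σ
      }
      where
      σ-inj : InjectiveBelow n (entry σ)
      σ-inj = Equivalence.to (isPerm⇔injective σ) perm
    from : Avoider j n (entry σ) → InS n (R5 (suc j)) σ
    from σ-av = Equivalence.from (isPerm⇔injective σ) (injective σ-av)
              , no-1243∨2143 σ-av ∘ contains-ab43⇒occ σ 1<3 2<3 3<4
              All.∷ no-1243∨2143 σ-av ∘ contains-ab43⇒occ σ 2<3 1<3 3<4
              All.∷ no-increasing σ-av ∘ contains-idPat⇒inc σ
              All.∷ All.[]
      where
      1<3 : 1 < 3
      1<3 = s<s z<s
      2<3 : 2 < 3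
      2<3 = s<s (s<s z<s)
      3<4 : 3 < 4
      3<4 = s<s (s<s (s<s z<s))

  module _ {A B : Set} where

    unique-map-on : ∀ {xs} (f : A → B) → Unique xs → (∀ {x y} → x ∈ xs → y ∈ xs → f x ≡ f y → x ≡ y) →
                    Unique (map f xs)
    unique-map-on f AllPairs.[]            _   = AllPairs.[]
    unique-map-on f (x∉xs AllPairs.∷ xs!) inj =
      Allₚ.map⁺ (All.tabulate λ y∈xs fx≡fy → All.lookup x∉xs y∈xs (inj (here refl) (there y∈xs) fx≡fy))
      AllPairs.∷ unique-map-on f xs! (λ x∈ y∈ → inj (there x∈) (there y∈))

  module _ {A B C : Set} where

    unique-cartesianProductWith-on : ∀ {xs ys} (f : A → B → C) → Unique xs → Unique ys →
      (∀ {w x y z} → w ∈ xs → x ∈ xs → y ∈ ys → z ∈ ys → f w y ≡ f x z → w ≡ x × y ≡ z) →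
      Unique (cartesianProductWith f xs ys)
    unique-cartesianProductWith-on f AllPairs.[] _ _ = AllPairs.[]
    unique-cartesianProductWith-on {x ∷ xs} {ys} f (x∉xs AllPairs.∷ xs!) ys! inj =
      Unique.++⁺ (unique-map-on (f x) ys! (λ y∈ z∈ → proj₂ ∘ inj (here refl) (here refl) y∈ z∈))
                 (unique-cartesianProductWith-on f xs! ys! (λ w∈ x∈ → inj (there w∈) (there x∈)))
                 disjoint
      where
      disjoint : Disjoint (map (f x) ys) (cartesianProductWith f xs ys)
      disjoint (v∈head , v∈rest) with ∈-map⁻ (f x) v∈head | ∈-cartesianProductWith⁻ f xs ys v∈rest
      ... | y , y∈ys , refl | w , z , w∈xs , z∈ys , fxy≡fwz =
        All.lookup x∉xs w∈xs (proj₁ (inj (here refl) (there w∈xs) y∈ys z∈ys fxy≡fwz))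

    length-cartesianProductWith : ∀ (f : A → B → C) xs ys →
                                  length (cartesianProductWith f xs ys) ≡ length xs * length ys
    length-cartesianProductWith f []       ys = refl
    length-cartesianProductWith f (x ∷ xs) ys = trans (length-++ (map (f x) ys))
      (cong₂ _+_ (length-map (f x) ys) (length-cartesianProductWith f xs ys))

  prependV : ∀ {N} → Vec (Fin N) N → Vec (Fin (suc N)) (suc N)
  prependV {N} β = fromFun (suc N) (prepend N (entry β))

  glueV : ∀ N i → Vec (Fin (suc i)) (suc i) → Vec (Fin (N ∸ i)) (N ∸ i) → Vec (Fin (suc N)) (suc N)
  glueV N i α ρ = fromFun (suc N) (glue (suc i) (N ∸ i) N (entry α) (entry ρ))

  entry-prependV : ∀ {N} (β : Vec (Fin N) N) p → p < suc N → entry (prependV β) p ≡ prepend N (entry β) p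
  entry-prependV {N} β zero    p<1+N     = entry-fromFun (prepend N (entry β)) p<1+N ≤-refl
  entry-prependV {N} β (suc p) (s≤s p<N) =
    entry-fromFun (prepend N (entry β)) (s≤s p<N) (m<n⇒m<1+n (entry<n β p p<N))

  prependV-injective : ∀ {N} {β β′ : Vec (Fin N) N} → prependV β ≡ prependV β′ → β ≡ β′
  prependV-injective {β = β} {β′} eq = entry-ext β β′ λ p p<N →
    trans (sym (entry-prependV β (suc p) (s≤s p<N)))
          (trans (cong (λ σ → entry σ (suc p)) eq) (entry-prependV β′ (suc p) (s≤s p<N)))

  prependV-avoider : ∀ {j N} (β : Vec (Fin N) N) → Avoider (suc j) N (entry β) →
                     Avoider (suc j) (suc N) (entry (prependV β))
  prependV-avoider β β-av = avoider-cong (λ p p< → sym (entry-prependV β p p<)) (prepend-avoider β-av)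

  glueV-max : ∀ {N i} (α : Vec (Fin (suc i)) (suc i)) (ρ : Vec (Fin (N ∸ i)) (N ∸ i)) → i < N →
              entry (glueV N i α ρ) (suc i) ≡ N
  glueV-max {N} {i} α ρ i<N = trans (entry-fromFun σ (s≤s i<N) (subst (_< suc N) (sym glue-top) ≤-refl)) glue-top
    where open Glue (suc i) (N ∸ i) N (entry α) (entry ρ)

  module _ {j N i : ℕ} (i<N : i < N) (α : Vec (Fin (suc i)) (suc i)) (ρ : Vec (Fin (N ∸ i)) (N ∸ i))
           (α-av : Avoider j (suc i) (entry α)) (ρ-av : Avoider (suc j) (N ∸ i) (entry ρ)) where

    private
      glued-av : Avoider (suc j) (suc N) (glue (suc i) (N ∸ i) N (entry α) (entry ρ))
      glued-av = glue-avoider α-av ρ-av (s≤s z≤n) (m<n⇒0<n∸m i<N) (cong suc (m+[n∸m]≡n (<⇒≤ i<N)))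

    entry-glueV : ∀ p → p < suc N → entry (glueV N i α ρ) p ≡ glue (suc i) (N ∸ i) N (entry α) (entry ρ) p
    entry-glueV p p<1+N = entry-fromFun (glue (suc i) (N ∸ i) N (entry α) (entry ρ)) p<1+N (bounded glued-av p p<1+N)

    glueV-avoider : Avoider (suc j) (suc N) (entry (glueV N i α ρ))
    glueV-avoider = avoider-cong (λ p p< → sym (entry-glueV p p<)) glued-av

  glueV-injective : ∀ {j N i} → i < N → (α α′ : Vec (Fin (suc i)) (suc i)) (ρ ρ′ : Vec (Fin (N ∸ i)) (N ∸ i)) →
                    Avoider j (suc i) (entry α) → Avoider j (suc i) (entry α′) →
                    Avoider (suc j) (N ∸ i) (entry ρ) → Avoider (suc j) (N ∸ i) (entry ρ′) →
                    glueV N i α ρ ≡ glueV N i α′ ρ′ → α ≡ α′ × ρ ≡ ρ′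
  glueV-injective {N = N} {i} i<N α α′ ρ ρ′ α-av α′-av ρ-av ρ′-av eq =
    entry-ext α α′ (proj₁ components) , entry-ext ρ ρ′ (proj₂ components)
    where
    same : ∀ p → p < suc N →
           glue (suc i) (N ∸ i) N (entry α) (entry ρ) p ≡ glue (suc i) (N ∸ i) N (entry α′) (entry ρ′) p
    same p p<1+N = trans (sym (entry-glueV i<N α ρ α-av ρ-av p p<1+N))
                         (trans (cong (λ σ → entry σ p) eq) (entry-glueV i<N α′ ρ′ α′-av ρ′-av p p<1+N))
    components : (∀ p → p < suc i → entry α p ≡ entry α′ p) × (∀ q → q < N ∸ i → entry ρ q ≡ entry ρ′ q)
    components = glue-injective (bounded α-av) (injective α-av) (s≤s z≤n)
                   (bounded ρ-av 0 (m<n⇒0<n∸m i<N)) (bounded ρ′-av 0 (m<n⇒0<n∸m i<N))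
                   (cong suc (m+[n∸m]≡n (<⇒≤ i<N))) same

  prepend-split : ∀ {j N} (σ : Vec (Fin (suc N)) (suc N)) → Avoider j (suc N) (entry σ) → entry σ 0 ≡ N →
                  ∃[ β ] Avoider j N (entry β) × σ ≡ prependV β
  prepend-split {j} {N} σ σ-av σ₀≡N = β , β-av , entry-ext σ (prependV β) same
    where
    tail-av : Avoider j N (entry σ ∘ suc)
    tail-av = tail-avoider σ-av σ₀≡N
    β : Vec (Fin N) N
    β = fromFun N (entry σ ∘ suc)
    β≗tail : ∀ p → p < N → entry β p ≡ entry σ (suc p)
    β≗tail p p<N = entry-fromFun (entry σ ∘ suc) p<N (bounded tail-av p p<N)
    β-av : Avoider j N (entry β)
    β-av = avoider-cong (λ p p<N → sym (β≗tail p p<N)) tail-av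
    same : ∀ p → p < suc N → entry σ p ≡ entry (prependV β) p
    same zero    p<1+N     = trans σ₀≡N (sym (entry-prependV β 0 p<1+N))
    same (suc p) (s≤s p<N) = trans (sym (β≗tail p p<N)) (sym (entry-prependV β (suc p) (s≤s p<N)))

  glue-split : ∀ {j N i} (σ : Vec (Fin (suc N)) (suc N)) → Avoider (suc j) (suc N) (entry σ) → i < N →
               entry σ (suc i) ≡ N →
               ∃[ α ] ∃[ ρ ] Avoider j (suc i) (entry α) × Avoider (suc j) (N ∸ i) (entry ρ) × σ ≡ glueV N i α ρ
  glue-split {j} {N} {i} σ σ-av i<N σ₁₊ᵢ≡N = αV , ρV , αV-av , ρV-av , entry-ext σ (glueV N i αV ρV) same
    where
    open Decomposition σ-av (s≤s z≤n) (s≤s i<N) σ₁₊ᵢ≡N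
    αV : Vec (Fin (suc i)) (suc i)
    αV = fromFun (suc i) α
    ρV : Vec (Fin (N ∸ i)) (N ∸ i)
    ρV = fromFun (N ∸ i) ρ
    αV≗α : ∀ p → p < suc i → entry αV p ≡ α p
    αV≗α p p< = entry-fromFun α p< (bounded α-avoider p p<)
    ρV≗ρ : ∀ q → q < N ∸ i → entry ρV q ≡ ρ q
    ρV≗ρ q q< = entry-fromFun ρ q< (bounded ρ-avoider q q<)
    αV-av : Avoider j (suc i) (entry αV)
    αV-av = avoider-cong (λ p p< → sym (αV≗α p p<)) α-avoider
    ρV-av : Avoider (suc j) (N ∸ i) (entry ρV)
    ρV-av = avoider-cong (λ q q< → sym (ρV≗ρ q q<)) ρ-avoider
    same : ∀ p → p < suc N → entry σ p ≡ entry (glueV N i αV ρV) p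
    same p p<1+N = begin
      entry σ p                                          ≡⟨ f≗glue p p<1+N ⟩
      glue (suc i) (N ∸ i) N α ρ p                       ≡⟨ glue-cong 0<b (λ p p< → sym (αV≗α p p<)) (λ q q< → sym (ρV≗ρ q q<))
                                                              p (subst (p <_) (sym a+b≡1+N) p<1+N) ⟩
      glue (suc i) (N ∸ i) N (entry αV) (entry ρV) p     ≡⟨ entry-glueV i<N αV ρV αV-av ρV-av p p<1+N ⟨
      entry (glueV N i αV ρV) p                          ∎
      where open ≡-Reasoning

  -- The fuel only makes the recursion structural: the list is complete as soon as fuel ≥ n.
  avoiders : (fuel j n : ℕ) → List (Vec (Fin n) n)
  gluings : (fuel j N i : ℕ) → List (Vec (Fin (suc N)) (suc N))

  avoiders _          zero    zero    = Vec.[] ∷ []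
  avoiders _          zero    (suc n) = []
  avoiders _          (suc j) zero    = Vec.[] ∷ []
  avoiders zero       (suc j) (suc N) = []
  avoiders (suc fuel) (suc j) (suc N) = map prependV (avoiders fuel (suc j) N) ++ concatMap (gluings fuel j N) (upTo N)

  gluings fuel j N i = cartesianProductWith (glueV N i) (avoiders fuel j (suc i)) (avoiders fuel (suc j) (N ∸ i))

  ∈-upTo⁻ : ∀ {i N} → i ∈ upTo N → i < N
  ∈-upTo⁻ i∈ with ∈-applyUpTo⁻ id i∈
  ... | _ , i<N , refl = i<N

  avoiders-sound : ∀ {fuel j n} {σ : Vec (Fin n) n} → σ ∈ avoiders fuel j n → Avoider j n (entry σ)
  gluings-sound : ∀ {fuel j N i} {σ : Vec (Fin (suc N)) (suc N)} → i < N → σ ∈ gluings fuel j N i →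
                  Avoider (suc j) (suc N) (entry σ)

  avoiders-sound {_}        {zero}  {zero}  _ = avoider-empty
  avoiders-sound {_}        {suc j} {zero}  _ = avoider-empty
  avoiders-sound {suc fuel} {suc j} {suc N} {σ} σ∈ with ∈-++⁻ (map prependV (avoiders fuel (suc j) N)) σ∈
  ... | inj₁ σ∈prepended with ∈-map⁻ prependV σ∈prepended
  ...   | β , β∈ , refl = prependV-avoider β (avoiders-sound β∈)
  avoiders-sound {suc fuel} {suc j} {suc N} {σ} σ∈ | inj₂ σ∈glued with find (∈-concatMap⁻ (gluings fuel j N) σ∈glued)
  ...   | i , i∈ , σ∈gluing = gluings-sound (∈-upTo⁻ i∈) σ∈gluing

  gluings-sound {fuel} {j} {N} {i} i<N σ∈ with ∈-cartesianProductWith⁻ (glueV N i) (avoiders fuel j (suc i)) _ σ∈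
  ... | α , ρ , α∈ , ρ∈ , refl = glueV-avoider i<N α ρ (avoiders-sound α∈) (avoiders-sound ρ∈)

  avoiders-complete : ∀ {fuel j n} (σ : Vec (Fin n) n) → n ≤ fuel → Avoider j n (entry σ) → σ ∈ avoiders fuel j n
  avoiders-complete {_}        {zero}  {zero}  Vec.[] _ _    = here refl
  avoiders-complete {_}        {suc j} {zero}  Vec.[] _ _    = here refl
  avoiders-complete {_}        {zero}  {suc n} _      _ σ-av = ⊥-elim (no-avoider₀ σ-av)
  avoiders-complete {suc fuel} {suc j} {suc N} σ (s≤s N≤fuel) σ-av with max-position σ-av
  ... | zero , _ , σ₀≡N with prepend-split σ σ-av σ₀≡N
  ...   | β , β-av , refl = ∈-++⁺ˡ (∈-map⁺ prependV (avoiders-complete β N≤fuel β-av))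
  avoiders-complete {suc fuel} {suc j} {suc N} σ (s≤s N≤fuel) σ-av | suc i , s≤s i<N , σ₁₊ᵢ≡N =
    glued (glue-split σ σ-av i<N σ₁₊ᵢ≡N)
    where
    glued : (∃[ α ] ∃[ ρ ] Avoider j (suc i) (entry α) × Avoider (suc j) (N ∸ i) (entry ρ) × σ ≡ glueV N i α ρ) →
            σ ∈ avoiders (suc fuel) (suc j) (suc N)
    glued (α , ρ , α-av , ρ-av , σ≡glued) = subst (_∈ avoiders (suc fuel) (suc j) (suc N)) (sym σ≡glued)
      (∈-++⁺ʳ (map prependV (avoiders fuel (suc j) N)) (∈-concatMap⁺ (gluings fuel j N) (lose (∈-applyUpTo⁺ id i<N)
        (∈-cartesianProductWith⁺ (glueV N i) (avoiders-complete α (≤-trans i<N N≤fuel) α-av)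
                                              (avoiders-complete ρ (≤-trans (m∸n≤m N i) N≤fuel) ρ-av)))))


  ∈-avoiders⇔ : ∀ {fuel j n} (σ : Vec (Fin n) n) → n ≤ fuel → σ ∈ avoiders fuel j n ⇔ Avoider j n (entry σ)
  ∈-avoiders⇔ σ n≤fuel = mk⇔ avoiders-sound (avoiders-complete σ n≤fuel)

  gluings-max : ∀ {fuel j N i} {σ : Vec (Fin (suc N)) (suc N)} → i < N → σ ∈ gluings fuel j N i →
                entry σ (suc i) ≡ N
  gluings-max {fuel} {j} {N} {i} {σ} i<N σ∈ =
    at-max (∈-cartesianProductWith⁻ (glueV N i) (avoiders fuel j (suc i)) _ σ∈)
    where
    at-max : (∃[ α ] ∃[ ρ ] α ∈ avoiders fuel j (suc i) × ρ ∈ avoiders fuel (suc j) (N ∸ i) × σ ≡ glueV N i α ρ) →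
             entry σ (suc i) ≡ N
    at-max (α , ρ , _ , _ , σ≡glued) = trans (cong (λ τ → entry τ (suc i)) σ≡glued) (glueV-max α ρ i<N)

  avoiders-unique : ∀ {fuel j n} → Unique (avoiders fuel j n)
  avoiders-unique {_}        {zero}  {zero}  = All.[] AllPairs.∷ AllPairs.[]
  avoiders-unique {_}        {zero}  {suc n} = AllPairs.[]
  avoiders-unique {_}        {suc j} {zero}  = All.[] AllPairs.∷ AllPairs.[]
  avoiders-unique {zero}     {suc j} {suc N} = AllPairs.[]
  avoiders-unique {suc fuel} {suc j} {suc N} =
    Unique.++⁺ (Unique.map⁺ {f = prependV} prependV-injective (avoiders-unique {fuel} {suc j} {N}))
               (Unique.concat⁺ (Allₚ.map⁺ (Allₚ.applyUpTo⁺₁ id N gluing-unique))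
                               (AllPairsₚ.map⁺ (AllPairsₚ.applyUpTo⁺₁ id N gluings-disjoint)))
               prepended-glued-disjoint
    where
    gluing-unique : ∀ {i} → i < N → Unique (gluings fuel j N i)
    gluing-unique {i} i<N =
      unique-cartesianProductWith-on (glueV N i)
        (avoiders-unique {fuel} {j} {suc i}) (avoiders-unique {fuel} {suc j} {N ∸ i})
        λ {α} {α′} {ρ} {ρ′} α∈ α′∈ ρ∈ ρ′∈ → glueV-injective i<N α α′ ρ ρ′
          (avoiders-sound α∈) (avoiders-sound α′∈) (avoiders-sound ρ∈) (avoiders-sound ρ′∈)

    -- The position of the maximum N tells the blocks apart.
    gluings-disjoint : ∀ {i i′} → i < i′ → i′ < N → Disjoint (gluings fuel j N i) (gluings fuel j N i′)
    gluings-disjoint {i} i<i′ i′<N (σ∈ , σ∈′) =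
      <⇒≢ i<i′ (suc-injective (injective (gluings-sound {fuel} {j} i′<N σ∈′) (s≤s i<N) (s≤s i′<N)
                 (trans (gluings-max {fuel} {j} i<N σ∈) (sym (gluings-max {fuel} {j} i′<N σ∈′)))))
      where
      i<N : i < N
      i<N = <-trans i<i′ i′<N

    prepended-glued-disjoint : Disjoint (map prependV (avoiders fuel (suc j) N)) (concatMap (gluings fuel j N) (upTo N))
    prepended-glued-disjoint {σ} (σ∈prepended , σ∈glued) =
      let β , _ , σ≡prepended = ∈-map⁻ prependV σ∈prepended
          i , i∈ , σ∈gluing = find (∈-concatMap⁻ (gluings fuel j N) σ∈glued)
          i<N = ∈-upTo⁻ i∈
          σ₀≡N = trans (cong (λ τ → entry τ 0) σ≡prepended) (entry-prependV β 0 (s≤s z≤n))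
      in 1+n≢0 (sym (injective (gluings-sound {fuel} {j} {N} i<N σ∈gluing) (s≤s z≤n) (s≤s i<N)
                       (trans σ₀≡N (sym (gluings-max {fuel} {j} {N} i<N σ∈gluing)))))

module Counting where

  open PowerSeries using (∑; ∑-cong; E; E-recurrence)
  open Avoiders using (avoiders; gluings; prependV; glueV; length-cartesianProductWith)
  open import Data.Integer using (_+_; _*_)
  open import Data.Integer.Properties using (pos-+; pos-*)
  open import Data.Nat as ℕ using (zero; suc; s≤s)
  open import Data.Nat.Properties using (≤-trans; m∸n≤m)
  open import Data.Fin using (Fin)
  open import Data.Vec using (Vec)
  open import Data.List using (List; _++_; map; concatMap; applyUpTo; upTo; length)
  open import Data.List.Properties using (length-++; length-map)
  open import Function using (_∘_; id)
  open import Relation.Binary.PropositionalEquality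

  +length-concatMap : ∀ {A : Set} (g : ℕ → List A) (h : ℕ → ℕ) n →
                      + length (concatMap g (applyUpTo h n)) ≡ ∑ n (λ i → + length (g (h i)))
  +length-concatMap g h zero    = refl
  +length-concatMap {A} g h (suc n) = begin
    + length (g (h 0) ++ rest)           ≡⟨ cong +_ (length-++ (g (h 0))) ⟩
    + (length (g (h 0)) ℕ.+ length rest) ≡⟨ pos-+ (length (g (h 0))) (length rest) ⟩
    + length (g (h 0)) + + length rest   ≡⟨ cong (_+_ (+ length (g (h 0)))) (+length-concatMap g (h ∘ suc) n) ⟩
    + length (g (h 0)) + ∑ n (λ i → + length (g (h (suc i))))
                                         ∎
    where
    open ≡-Reasoning
    rest : List A
    rest = concatMap g (applyUpTo (h ∘ suc) n)

  length-avoiders : ∀ {fuel j n} → n ≤ fuel → + length (avoiders fuel j n) ≡ E j n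
  length-avoiders {_}        {zero}  {zero}  _ = refl
  length-avoiders {_}        {zero}  {suc n} _ = refl
  length-avoiders {_}        {suc j} {zero}  _ = refl
  length-avoiders {suc fuel} {suc j} {suc N} (s≤s N≤fuel) = begin
    + length (map prependV prepended ++ concatMap (gluings fuel j N) (upTo N))
      ≡⟨ cong +_ (length-++ (map prependV prepended)) ⟩
    + (length (map prependV prepended) ℕ.+ length (concatMap (gluings fuel j N) (upTo N)))
      ≡⟨ pos-+ (length (map prependV prepended)) _ ⟩
    + length (map prependV prepended) + + length (concatMap (gluings fuel j N) (upTo N))
      ≡⟨ cong₂ _+_ (trans (cong +_ (length-map prependV prepended)) (length-avoiders {fuel} {suc j} N≤fuel))
                   (+length-concatMap (gluings fuel j N) id N) ⟩
    E (suc j) N + ∑ N (λ i → + length (gluings fuel j N i))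
      ≡⟨ cong (_+_ (E (suc j) N)) (∑-cong N block) ⟩
    E (suc j) N + ∑ N (λ i → E j (suc i) * E (suc j) (N ∸ i))
      ≡⟨ E-recurrence j N ⟨
    E (suc j) (suc N)
      ∎
    where
    open ≡-Reasoning
    prepended : List (Vec (Fin N) N)
    prepended = avoiders fuel (suc j) N
    block : ∀ i → i ℕ.< N → + length (gluings fuel j N i) ≡ E j (suc i) * E (suc j) (N ∸ i)
    block i i<N = begin
      + length (gluings fuel j N i)     ≡⟨ cong +_ (length-cartesianProductWith (glueV N i) lefts rights) ⟩
      + (length lefts ℕ.* length rights) ≡⟨ pos-* (length lefts) (length rights) ⟩
      + length lefts * + length rights   ≡⟨ cong₂ _*_ (length-avoiders {fuel} {j} (≤-trans i<N N≤fuel))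
                                                     (length-avoiders {fuel} {suc j} (≤-trans (m∸n≤m N i) N≤fuel)) ⟩
      E j (suc i) * E (suc j) (N ∸ i)   ∎
      where
      lefts : List (Vec (Fin (suc i)) (suc i))
      lefts = avoiders fuel j (suc i)
      rights : List (Vec (Fin (N ∸ i)) (N ∸ i))
      rights = avoiders fuel (suc j) (N ∸ i)

open Avoiders using (avoiders; avoiders-unique; ∈-avoiders⇔; InS⇔avoider)
open Counting using (length-avoiders)
open import Data.Nat using (zero; suc)
open import Data.Nat.Properties using (≤-refl)
open import Data.List using (length)
open import Data.Product using (_,_)
import Function.Properties.Equivalence as ⇔
open import Relation.Binary.PropositionalEquality using (refl)

corollary5p5 : (k : ℕ) → 1 ≤ k → (n : ℕ) →
    Σ ℕ λ c → CardS n (R5 k) c × (+ c ≡ (onePS ⊕ K (k ∸ 1)) n)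
corollary5p5 zero    () n
corollary5p5 (suc j) _  n =
  length (avoiders n j n) ,
  (avoiders n j n , avoiders-unique {n} {j} ,
   (λ σ → ⇔.trans (∈-avoiders⇔ σ ≤-refl) (⇔.sym (InS⇔avoider σ))) , refl) ,
  length-avoiders {n} {j} ≤-refl
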